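{- For every integer $k\ge 0$ and every integer $n$, we have $m_{k,n}=a_{k-n,\,k+n}$.
   Context: For nonnegative integers $k,n$, let $a_{k,n}$ be the number of ways to partition a set consisting of $k$ marked points on a line and $n$ marked points on a second line parallel to it into pairs, joining the two points of each pair by a straight segment, such that no two of these segments have a common point (in particular, no endpoint lies on another segment). This number does not depend on the positions of the points. We have $a_{0,0}=1$, and $a_{k,n}=0$ if $k+n$ is odd. By convention $a_{k,n}=0$ if $k<0$ or $n<0$. A Motzkin path is a lattice path starting at $(0,0)$ whose steps are $(1,0)$, $(1,1)$ or $(1,-1)$. The path is not required to stay above the $x$-axis. It is peakless if no step $(1,1)$ is immediately followed by a step $(1,-1)$. $m_{k,n}$ denotes the number of peakless Motzkin paths from $(0,0)$ to $(k,n)$. -}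

module Defs where

open import Data.Nat as ℕ using (ℕ; zero; suc; _<_; _≤_; _<?_; _≤?_)
open import Data.Integer as ℤ using (ℤ; +_; -[1+_])
open import Data.Fin using (Fin; toℕ)
open import Data.Fin.Properties using (all?)
open import Data.List using (List; []; _∷_; [_]; length; filter; map; concatMap; allFin)
open import Data.Vec using (Vec; []; _∷_; lookup; toList)
open import Data.Product using (_×_; _,_)
open import Data.Sum using (_⊎_)
open import Data.Unit using (⊤; tt)
open import Data.Empty using (⊥)
open import Relation.Nullary using (Dec; yes; no; ¬_)
open import Relation.Nullary.Decidable using (_×-dec_; _⊎-dec_; _→-dec_; ¬?)
open import Relation.Binary.PropositionalEquality using (_≡_; _≢_)
import Data.Fin as Fin

allVecs : {A : Set} → List A → (N : ℕ) → List (Vec A N)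
allVecs xs zero = [ [] ]
allVecs xs (suc N) = concatMap (λ x → map (x ∷_) (allVecs xs N)) xs

-- Non-crossing pairings of k points on one line and n points on a
-- parallel line.
--
-- The k + n points are indexed by Fin (k + n): index i with toℕ i < k is
-- the (toℕ i)-th point (from the left) on the first line; index i with
-- k ≤ toℕ i is the (toℕ i ∸ k)-th point (from the left, same orientation)
-- on the second line.  A partition into pairs is a fixed-point-free
-- involution f (stored as the vector of its values).
--
-- Geometric non-intersection condition, rendered combinatorially:
--  * a segment joining two points of the same line lies on that line, so
--    it must contain no other marked point: the two points are adjacent;
--  * two segments joining the two lines, (a , b) and (a' , b') with a, a'
--    on the first line and b, b' on the second, meet iff their orders
--    disagree, i.e. a < a' and b' < b;
--  * a segment between the lines and a segment inside a line meet only
--    at a common endpoint, impossible since pairs are disjoint.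

SameLine : (k : ℕ) {N : ℕ} → Fin N → Fin N → Set
SameLine k i j = (toℕ i < k × toℕ j < k) ⊎ (k ≤ toℕ i × k ≤ toℕ j)

Adjacent : {N : ℕ} → Fin N → Fin N → Set
Adjacent i j = (suc (toℕ i) ≡ toℕ j) ⊎ (suc (toℕ j) ≡ toℕ i)

IsNonCrossingPairing : (k n : ℕ) → Vec (Fin (k ℕ.+ n)) (k ℕ.+ n) → Set
IsNonCrossingPairing k n f =
  (∀ i → lookup f (lookup f i) ≡ i) ×
  (∀ i → lookup f i ≢ i) ×
  (∀ i → SameLine k i (lookup f i) → Adjacent i (lookup f i)) ×
  (∀ i j → toℕ i < k → k ≤ toℕ (lookup f i) →
           toℕ j < k → k ≤ toℕ (lookup f j) →
           toℕ i < toℕ j → toℕ (lookup f i) < toℕ (lookup f j))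

isNonCrossingPairing? : (k n : ℕ) → (f : Vec (Fin (k ℕ.+ n)) (k ℕ.+ n)) →
                        Dec (IsNonCrossingPairing k n f)
isNonCrossingPairing? k n f =
  all? (λ i → lookup f (lookup f i) Fin.≟ i) ×-dec
  (all? (λ i → ¬? (lookup f i Fin.≟ i)) ×-dec
  (all? (λ i → sameLine? i (lookup f i) →-dec adjacent? i (lookup f i)) ×-dec
   all? (λ i → all? (λ j →
     (toℕ i <? k) →-dec ((k ≤? toℕ (lookup f i)) →-dec ((toℕ j <? k) →-dec
       ((k ≤? toℕ (lookup f j)) →-dec ((toℕ i <? toℕ j) →-dec
         (toℕ (lookup f i) <? toℕ (lookup f j))))))))))
  where
  sameLine? : ∀ i j → Dec (SameLine k i j)
  sameLine? i j = ((toℕ i <? k) ×-dec (toℕ j <? k)) ⊎-dec ((k ≤? toℕ i) ×-dec (k ≤? toℕ j))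
  adjacent? : ∀ (i j : Fin (k ℕ.+ n)) → Dec (Adjacent i j)
  adjacent? i j = (suc (toℕ i) ℕ.≟ toℕ j) ⊎-dec (suc (toℕ j) ℕ.≟ toℕ i)

aℕ : ℕ → ℕ → ℕ
aℕ k n = length (filter (isNonCrossingPairing? k n) (allVecs (allFin (k ℕ.+ n)) (k ℕ.+ n)))

a : ℤ → ℤ → ℕ
a (+ k) (+ n) = aℕ k n
a (+ k) -[1+ n ] = 0
a -[1+ k ] n = 0

-- Peakless Motzkin paths (not required to stay above the x-axis)

data Step : Set where
  U H D : Step

allSteps : List Step
allSteps = U ∷ H ∷ D ∷ []

stepHeight : Step → ℤ
stepHeight U = + 1
stepHeight H = + 0
stepHeight D = ℤ.- (+ 1)

height : List Step → ℤ
height [] = + 0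
height (s ∷ ss) = stepHeight s ℤ.+ height ss

Peakless : List Step → Set
Peakless [] = ⊤
Peakless (U ∷ []) = ⊤
Peakless (U ∷ U ∷ ss) = Peakless (U ∷ ss)
Peakless (U ∷ H ∷ ss) = Peakless (H ∷ ss)
Peakless (U ∷ D ∷ ss) = ⊥
Peakless (H ∷ ss) = Peakless ss
Peakless (D ∷ ss) = Peakless ss

peakless? : (ss : List Step) → Dec (Peakless ss)
peakless? [] = yes tt
peakless? (U ∷ []) = yes tt
peakless? (U ∷ U ∷ ss) = peakless? (U ∷ ss)
peakless? (U ∷ H ∷ ss) = peakless? (H ∷ ss)
peakless? (U ∷ D ∷ ss) = no (λ ())
peakless? (H ∷ ss) = peakless? ss
peakless? (D ∷ ss) = peakless? ss

IsPeaklessPathTo : ℤ → {k : ℕ} → Vec Step k → Set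
IsPeaklessPathTo n p = Peakless (toList p) × height (toList p) ≡ n

isPeaklessPathTo? : (n : ℤ) {k : ℕ} (p : Vec Step k) → Dec (IsPeaklessPathTo n p)
isPeaklessPathTo? n p = peakless? (toList p) ×-dec (height (toList p) ℤ.≟ n)

m : ℕ → ℤ → ℕ
m k n = length (filter (isPeaklessPathTo? n) (allVecs allSteps k))

-- Both sides, each paired with a companion count, satisfy the same recurrence in the length N
-- and the final height n, with the same values at N = 0.  For paths the companion m⁺ counts the
-- paths not starting with a down step; splitting by the first step gives
-- m (N+1) n = m⁺ (N+1) n + m N (n+1) and m⁺ (N+1) n = m⁺ N (n-1) + m N n.
-- For pairings, in the coordinates x = N - n, y = N + n, the companion b x y counts the pairings
-- in which the leftmost point of the first line is joined to the second line.  Either that point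
-- is joined to its neighbour, and the two can be removed, or it goes across:
-- a (x+2) y = a x y + b (x+2) y.  In the second case, either the leftmost point of the second line
-- is joined to its neighbour, or non-crossing forces it to be joined to the leftmost point of the
-- first line: b x (y+2) = b x y + a (x-1) (y+1).  Each removal of a joined pair is a bijection
-- onto the pairings of the smaller configuration.
module Submission where

module Counting where

  open import Data.Nat using (ℕ; zero; suc; _+_; _≤_; z≤n)
  open import Data.Nat.Properties using (≤-antisym; +-suc; +-monoˡ-≤; +-monoʳ-≤; module ≤-Reasoning)
  open import Data.List using (List; []; _∷_; length; filter; map; concatMap; _++_)
  open import Data.Nat.ListAction using (sum)
  open import Data.List.Properties
    using (length-map; length-++; filter-++; filter-≐; filter-none; filter-some; map-cong)
  open import Data.List.Relation.Unary.All as All using (All; []; _∷_)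
  import Data.List.Relation.Unary.All.Properties as All
  open import Data.List.Relation.Unary.Any as Any using (here; there)
  open import Data.List.Relation.Unary.AllPairs using ([]; _∷_)
  open import Data.List.Relation.Unary.Unique.Propositional using (Unique)
  open import Data.List.Relation.Unary.Unique.Propositional.Properties as Unique using ()
  open import Data.List.Membership.Propositional using (_∈_)
  open import Data.List.Membership.Propositional.Properties
    using (∈-filter⁺; ∈-filter⁻; ∈-map⁺; ∈-map⁻; ∈-concatMap⁺; ∈-concatMap⁻)
  open import Data.Vec using (Vec; []; _∷_)
  open import Data.Vec.Properties using (∷-injectiveˡ; ∷-injectiveʳ)
  open import Data.Product using (_×_; _,_; proj₁; proj₂)
  open import Function using (_∘_)
  open import Level using (0ℓ)
  open import Relation.Nullary using (yes; no; ¬_)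
  open import Relation.Unary using (Pred; Decidable; _≐_)
  open import Relation.Unary.Properties using (_∩?_; ∁?)
  open import Relation.Binary.Definitions using (DecidableEquality)
  open import Relation.Binary.PropositionalEquality

  open import Defs using (allVecs)

  private
    variable
      A B : Set
      N : ℕ

  count : {P : Pred A 0ℓ} → Decidable P → List A → ℕ
  count P? xs = length (filter P? xs)

  module _ {P : Pred A 0ℓ} (P? : Decidable P) where

    count-++ : ∀ xs ys → count P? (xs ++ ys) ≡ count P? xs + count P? ys
    count-++ xs ys = trans (cong length (filter-++ P? xs ys)) (length-++ (filter P? xs))

    count-map : (f : B → A) (xs : List B) → count P? (map f xs) ≡ count (P? ∘ f) xs
    count-map f [] = refl
    count-map f (x ∷ xs) with P? (f x)
    ... | yes _ = cong suc (count-map f xs)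
    ... | no _ = count-map f xs

    count-concatMap : (f : B → List A) (xs : List B) → count P? (concatMap f xs) ≡ sum (map (count P? ∘ f) xs)
    count-concatMap f [] = refl
    count-concatMap f (x ∷ xs) =
      trans (count-++ (f x) (concatMap f xs)) (cong (count P? (f x) +_) (count-concatMap f xs))

    count-none : (∀ x → ¬ P x) → ∀ xs → count P? xs ≡ 0
    count-none ¬P xs = cong length (filter-none P? (All.universal ¬P xs))

    length≡count+count∁ : ∀ xs → length xs ≡ count P? xs + count (∁? P?) xs
    length≡count+count∁ [] = refl
    length≡count+count∁ (x ∷ xs) with P? x
    ... | yes _ = cong suc (length≡count+count∁ xs)
    ... | no _ = trans (cong suc (length≡count+count∁ xs)) (sym (+-suc _ _))

    module _ {Q : Pred A 0ℓ} (Q? : Decidable Q) where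

      count-split : ∀ xs → count P? xs ≡ count (P? ∩? Q?) xs + count (P? ∩? ∁? Q?) xs
      count-split [] = refl
      count-split (x ∷ xs) with P? x | Q? x
      ... | yes _ | yes _ = cong suc (count-split xs)
      ... | yes _ | no _ = trans (cong suc (count-split xs)) (sym (+-suc _ _))
      ... | no _ | _ = count-split xs

      count-cong : P ≐ Q → ∀ xs → count P? xs ≡ count Q? xs
      count-cong P≐Q xs = cong length (filter-≐ P? Q? P≐Q xs)

  count-∩?-universal : {P Q : Pred A 0ℓ} (P? : Decidable P) (Q? : Decidable Q) →
                       (∀ x → Q x) → ∀ xs → count (P? ∩? Q?) xs ≡ count P? xs
  count-∩?-universal P? Q? universal = count-cong (P? ∩? Q?) P? (proj₁ , λ {x} Px → Px , universal x)

  Unique-⊆⇒length≤ : DecidableEquality A → {xs ys : List A} → Unique xs →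
                     (∀ {x} → x ∈ xs → x ∈ ys) → length xs ≤ length ys
  Unique-⊆⇒length≤ _≟_ {[]} _ _ = z≤n
  Unique-⊆⇒length≤ _≟_ {x ∷ xs} {ys} (x∉xs ∷ xs!) xs⊆ys = begin
    suc (length xs)                         ≤⟨ +-monoˡ-≤ (length xs) x∈filter ⟩
    count (x ≟_) ys + length xs              ≤⟨ +-monoʳ-≤ (count (x ≟_) ys) rest ⟩
    count (x ≟_) ys + count (∁? (x ≟_)) ys   ≡⟨ length≡count+count∁ (x ≟_) ys ⟨
    length ys                                ∎
    where
    open Data.Nat.Properties.≤-Reasoning
    x∈filter : 1 ≤ count (x ≟_) ys
    x∈filter = filter-some (x ≟_) (xs⊆ys (here refl))
    rest : length xs ≤ count (∁? (x ≟_)) ys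
    rest = Unique-⊆⇒length≤ _≟_ xs! (λ y∈xs →
      ∈-filter⁺ (∁? (x ≟_)) (xs⊆ys (there y∈xs)) (All.lookup x∉xs y∈xs))

  record IsEnumeration (xs : List A) : Set where
    field
      unique : Unique xs
      complete : ∀ x → x ∈ xs

  Unique-map⁺-on : {P : Pred A 0ℓ} (φ : A → B) → (∀ {a a′} → P a → P a′ → φ a ≡ φ a′ → a ≡ a′) →
                   ∀ {zs} → All P zs → Unique zs → Unique (map φ zs)
  Unique-map⁺-on φ inj [] _ = []
  Unique-map⁺-on φ inj {z ∷ zs} (Pz ∷ P-zs) (z∉zs ∷ zs!) = All.tabulate fresh ∷ Unique-map⁺-on φ inj P-zs zs!
    where
    fresh : ∀ {w} → w ∈ map φ zs → φ z ≢ w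
    fresh w∈ eq with ∈-map⁻ φ w∈
    ... | z′ , z′∈zs , refl = All.lookup z∉zs z′∈zs (inj Pz (All.lookup P-zs z′∈zs) eq)

  count-≤-by-injection : {P : Pred A 0ℓ} {Q : Pred B 0ℓ} (P? : Decidable P) (Q? : Decidable Q) →
    DecidableEquality B → {xs : List A} {ys : List B} → Unique xs → (∀ b → b ∈ ys) →
    (φ : A → B) → (∀ a → P a → Q (φ a)) → (∀ {a a′} → P a → P a′ → φ a ≡ φ a′ → a ≡ a′) →
    count P? xs ≤ count Q? ys
  count-≤-by-injection P? Q? _≟_ {xs} {ys} xs! ys-complete φ P⇒Qφ inj = begin
    count P? xs                   ≡⟨ length-map φ (filter P? xs) ⟨
    length (map φ (filter P? xs)) ≤⟨ Unique-⊆⇒length≤ _≟_ φ[P-xs]! image⊆ ⟩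
    count Q? ys                   ∎
    where
    open ≤-Reasoning
    φ[P-xs]! : Unique (map φ (filter P? xs))
    φ[P-xs]! = Unique-map⁺-on φ inj (All.all-filter P? xs) (Unique.filter⁺ P? xs!)
    image⊆ : ∀ {b} → b ∈ map φ (filter P? xs) → b ∈ filter Q? ys
    image⊆ b∈ with ∈-map⁻ φ b∈
    ... | a , a∈ , refl = ∈-filter⁺ Q? (ys-complete (φ a)) (P⇒Qφ a (proj₂ (∈-filter⁻ P? {xs = xs} a∈)))

  count-≡-by-inverses : {P : Pred A 0ℓ} {Q : Pred B 0ℓ} (P? : Decidable P) (Q? : Decidable Q) →
    DecidableEquality A → DecidableEquality B → {xs : List A} {ys : List B} →
    IsEnumeration xs → IsEnumeration ys →
    (φ : A → B) (ψ : B → A) → (∀ a → P a → Q (φ a)) → (∀ b → Q b → P (ψ b)) →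
    (∀ a → P a → ψ (φ a) ≡ a) → (∀ b → Q b → φ (ψ b) ≡ b) →
    count P? xs ≡ count Q? ys
  count-≡-by-inverses P? Q? _≟A_ _≟B_ exs eys φ ψ P⇒Qφ Q⇒Pψ ψφ φψ =
    ≤-antisym
      (count-≤-by-injection P? Q? _≟B_ (unique exs) (complete eys) φ P⇒Qφ
        (λ {a} {a′} Pa Pa′ eq → trans (sym (ψφ a Pa)) (trans (cong ψ eq) (ψφ a′ Pa′))))
      (count-≤-by-injection Q? P? _≟A_ (unique eys) (complete exs) ψ Q⇒Pψ
        (λ {b} {b′} Qb Qb′ eq → trans (sym (φψ b Qb)) (trans (cong φ eq) (φψ b′ Qb′))))
    where open IsEnumeration

  allVecs-isEnumeration : {xs : List A} → IsEnumeration xs → ∀ N → IsEnumeration (allVecs xs N)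
  allVecs-isEnumeration {A = A} {xs} exs N = record { unique = unique′ N ; complete = complete′ N }
    where
    open IsEnumeration exs

    complete′ : ∀ N v → v ∈ allVecs xs N
    complete′ zero [] = here refl
    complete′ (suc N) (x ∷ v) =
      ∈-concatMap⁺ (λ y → map (y ∷_) (allVecs xs N))
        (Any.map (λ { refl → ∈-map⁺ (x ∷_) (complete′ N v) }) (complete x))

    unique′ : ∀ N → Unique (allVecs xs N)
    unique′ zero = All.[] ∷ []
    unique′ (suc N) = prefixed-unique xs unique
      where
      vs : List (Vec A N)
      vs = allVecs xs N
      prefixed : List A → List (Vec A (suc N))
      prefixed = concatMap (λ z → map (z ∷_) vs)

      head∈ : ∀ zs {x v} → x ∷ v ∈ prefixed zs → x ∈ zs
      head∈ zs v∈ = Any.map (λ x∷v∈ → let _ , _ , eq = ∈-map⁻ (_ ∷_) x∷v∈ in ∷-injectiveˡ eq)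
                            (∈-concatMap⁻ (λ z → map (z ∷_) vs) {xs = zs} v∈)

      prefixed-unique : ∀ zs → Unique zs → Unique (prefixed zs)
      prefixed-unique [] _ = []
      prefixed-unique (z ∷ zs) (z∉zs ∷ zs!) =
        Unique.++⁺ (Unique.map⁺ ∷-injectiveʳ (unique′ N)) (prefixed-unique zs zs!) disjoint
        where
        disjoint : ∀ {v} → ¬ (v ∈ map (z ∷_) vs × v ∈ prefixed zs)
        disjoint (v∈₁ , v∈₂) with ∈-map⁻ (z ∷_) v∈₁
        ... | _ , _ , refl = All.lookup z∉zs (head∈ zs v∈₂) refl

  count-allVecs-suc : {P : Pred (Vec A (suc N)) 0ℓ} (P? : Decidable P) (xs : List A) →
    count P? (allVecs xs (suc N)) ≡ sum (map (λ x → count (P? ∘ (x ∷_)) (allVecs xs N)) xs)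
  count-allVecs-suc {N = N} P? xs =
    trans (count-concatMap P? _ xs) (cong sum (map-cong (λ x → count-map P? (x ∷_) (allVecs xs N)) xs))

module Recurrence where

  open import Data.Nat as ℕ using (ℕ; zero; suc)
  open import Data.Integer using (ℤ; +_; _+_; _-_)
  open import Data.Product using (_×_; _,_; proj₁; proj₂)
  open import Relation.Binary.PropositionalEquality

  record PeaklessRecurrence (A B : ℕ → ℤ → ℕ) : Set where
    field
      A-suc : ∀ N n → A (suc N) n ≡ B (suc N) n ℕ.+ A N (n + + 1)
      B-suc : ∀ N n → B (suc N) n ≡ B N (n - + 1) ℕ.+ A N n

  PeaklessRecurrence-unique : ∀ {A B A′ B′} → PeaklessRecurrence A B → PeaklessRecurrence A′ B′ →
    (∀ n → A 0 n ≡ A′ 0 n) → (∀ n → B 0 n ≡ B′ 0 n) → ∀ N n → A N n ≡ A′ N n × B N n ≡ B′ N n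
  PeaklessRecurrence-unique r r′ A₀ B₀ zero n = A₀ n , B₀ n
  PeaklessRecurrence-unique {A} {B} {A′} {B′} r r′ A₀ B₀ (suc N) n = A-eq , B-eq
    where
    open PeaklessRecurrence
    ih : ∀ n → A N n ≡ A′ N n × B N n ≡ B′ N n
    ih = PeaklessRecurrence-unique r r′ A₀ B₀ N
    B-eq : B (suc N) n ≡ B′ (suc N) n
    B-eq = trans (B-suc r N n) (trans (cong₂ ℕ._+_ (proj₂ (ih (n - + 1))) (proj₁ (ih n))) (sym (B-suc r′ N n)))
    A-eq : A (suc N) n ≡ A′ (suc N) n
    A-eq = trans (A-suc r N n) (trans (cong₂ ℕ._+_ B-eq (proj₁ (ih (n + + 1)))) (sym (A-suc r′ N n)))

module PathCounts where

  open import Data.Nat as ℕ using (ℕ; suc)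
  open import Data.Nat.Properties as ℕ using ()
  open import Data.Integer using (ℤ; +_; _+_; _-_)
  open import Data.Integer.Properties using (+-identityˡ)
  open import Data.Integer.Tactic.RingSolver using (solve-∀)
  open import Data.List using (List; []; _∷_)
  open import Data.Vec as Vec using (Vec; toList)
  open import Data.Product using (_×_; _,_; proj₁; proj₂)
  open import Data.Unit using (⊤; tt)
  open import Data.Empty using (⊥)
  open import Function using (_∘_; _⇔_; mk⇔; Equivalence)
  open import Relation.Nullary using (Dec; yes; no)
  open import Relation.Unary using (Decidable)
  open import Relation.Unary.Properties using (_∩?_)
  open import Relation.Binary.PropositionalEquality

  open import Defs
  open Counting
  open Recurrence

  private
    variable
      N : ℕ

  NoLeadingD : List Step → Set
  NoLeadingD (D ∷ _) = ⊥
  NoLeadingD _ = ⊤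

  noLeadingD? : (ss : List Step) → Dec (NoLeadingD ss)
  noLeadingD? [] = yes tt
  noLeadingD? (U ∷ _) = yes tt
  noLeadingD? (H ∷ _) = yes tt
  noLeadingD? (D ∷ _) = no λ ()

  m⁺ : ℕ → ℤ → ℕ
  m⁺ N n = count (isPeaklessPathTo? n ∩? (noLeadingD? ∘ toList)) (allVecs allSteps N)

  Peakless-U∷⇔ : ∀ ss → Peakless (U ∷ ss) ⇔ (Peakless ss × NoLeadingD ss)
  Peakless-U∷⇔ ss = mk⇔ (to ss) (from ss)
    where
    to : ∀ ss → Peakless (U ∷ ss) → Peakless ss × NoLeadingD ss
    to [] _ = tt , tt
    to (U ∷ _) p = p , tt
    to (H ∷ _) p = p , tt
    from : ∀ ss → Peakless ss × NoLeadingD ss → Peakless (U ∷ ss)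
    from [] _ = tt
    from (U ∷ _) (p , _) = p
    from (H ∷ _) (p , _) = p

  +-≡⇔≡-ʳ : ∀ a h n → a + h ≡ n ⇔ h ≡ n - a
  +-≡⇔≡-ʳ a h n = mk⇔
    (λ eq → trans (cancel a h) (cong (_- a) eq))
    (λ eq → trans (cong (λ x → a + x) eq) (cancel′ a n))
    where
    cancel : ∀ a h → h ≡ a + h - a
    cancel = solve-∀
    cancel′ : ∀ a n → a + (n - a) ≡ n
    cancel′ = solve-∀

  height-∷⇔ : ∀ s ss n → height (s ∷ ss) ≡ n ⇔ height ss ≡ n - stepHeight s
  height-∷⇔ s ss n = +-≡⇔≡-ʳ (stepHeight s) (height ss) n

  private
    paths : (N : ℕ) → List (Vec Step N)
    paths = allVecs allSteps

  count-paths-U∷ : ∀ N n → count (isPeaklessPathTo? n ∘ (U Vec.∷_)) (paths N) ≡ m⁺ N (n - + 1)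
  count-paths-U∷ N n = count-cong _ _ (forward , backward) (paths N)
    where
    open Equivalence
    forward : ∀ {v} → IsPeaklessPathTo n (U Vec.∷ v) → IsPeaklessPathTo (n - + 1) v × NoLeadingD (toList v)
    forward {v} (p , h) =
      let p′ , d = Peakless-U∷⇔ (toList v) .to p in (p′ , height-∷⇔ U (toList v) n .to h) , d
    backward : ∀ {v} → IsPeaklessPathTo (n - + 1) v × NoLeadingD (toList v) → IsPeaklessPathTo n (U Vec.∷ v)
    backward {v} ((p , h) , d) = Peakless-U∷⇔ (toList v) .from (p , d) , height-∷⇔ U (toList v) n .from h

  count-paths-H∷ : ∀ N n → count (isPeaklessPathTo? n ∘ (H Vec.∷_)) (paths N) ≡ m N n
  count-paths-H∷ N n = count-cong _ _
    ((λ (p , h) → p , trans (sym (+-identityˡ _)) h) , (λ (p , h) → p , trans (+-identityˡ _) h)) (paths N)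

  count-paths-D∷ : ∀ N n → count (isPeaklessPathTo? n ∘ (D Vec.∷_)) (paths N) ≡ m N (n + + 1)
  count-paths-D∷ N n = count-cong _ _
    ((λ {v} (p , h) → p , height-∷⇔ D (toList v) n .to h) ,
     (λ {v} (p , h) → p , height-∷⇔ D (toList v) n .from h)) (paths N)
    where open Equivalence

  m-suc : ∀ N n → m (suc N) n ≡ m⁺ N (n - + 1) ℕ.+ (m N n ℕ.+ (m N (n + + 1) ℕ.+ 0))
  m-suc N n = trans (count-allVecs-suc {N = N} (isPeaklessPathTo? n) allSteps)
    (cong₂ ℕ._+_ (count-paths-U∷ N n) (cong₂ ℕ._+_ (count-paths-H∷ N n) (cong (ℕ._+ 0) (count-paths-D∷ N n))))

  m⁺-suc : ∀ N n → m⁺ (suc N) n ≡ m⁺ N (n - + 1) ℕ.+ (m N n ℕ.+ 0)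
  m⁺-suc N n = trans (count-allVecs-suc {N = N} P? allSteps)
    (cong₂ ℕ._+_ (trans (count-∩?-universal (isPeaklessPathTo? n ∘ (U Vec.∷_)) (λ _ → yes tt) _ (paths N))
                        (count-paths-U∷ N n))
    (cong₂ ℕ._+_ (trans (count-∩?-universal (isPeaklessPathTo? n ∘ (H Vec.∷_)) (λ _ → yes tt) _ (paths N))
                        (count-paths-H∷ N n))
    (cong (ℕ._+ 0) (count-none (P? ∘ (D Vec.∷_)) (λ _ ()) (paths N)))))
    where
    P? : Decidable (λ (v : Vec Step (suc N)) → IsPeaklessPathTo n v × NoLeadingD (toList v))
    P? = isPeaklessPathTo? n ∩? (noLeadingD? ∘ toList)

  paths-peaklessRecurrence : PeaklessRecurrence m m⁺
  paths-peaklessRecurrence = record { A-suc = A-suc ; B-suc = B-suc }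
    where
    B-suc : ∀ N n → m⁺ (suc N) n ≡ m⁺ N (n - + 1) ℕ.+ m N n
    B-suc N n = trans (m⁺-suc N n) (cong (m⁺ N (n - + 1) ℕ.+_) (ℕ.+-identityʳ (m N n)))
    A-suc : ∀ N n → m (suc N) n ≡ m⁺ (suc N) n ℕ.+ m N (n + + 1)
    A-suc N n = begin
      m (suc N) n                                      ≡⟨ m-suc N n ⟩
      u ℕ.+ (h ℕ.+ (d ℕ.+ 0))                          ≡⟨ cong (λ x → u ℕ.+ (h ℕ.+ x)) (ℕ.+-identityʳ d) ⟩
      u ℕ.+ (h ℕ.+ d)                                  ≡⟨ ℕ.+-assoc u h d ⟨
      (u ℕ.+ h) ℕ.+ d                                  ≡⟨ cong (ℕ._+ d) (B-suc N n) ⟨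
      m⁺ (suc N) n ℕ.+ d                               ∎
      where
      open ≡-Reasoning
      u h d : ℕ
      u = m⁺ N (n - + 1)
      h = m N n
      d = m N (n + + 1)

module IndexFunctions where

  open import Data.Nat using (ℕ; zero; suc; _+_; _≤_; _<_; z≤n; s≤s; _<?_)
  open import Data.Nat.Properties using (≤-trans; m≤m+n)
  open import Data.Fin using (Fin; toℕ; fromℕ<) renaming (zero to fzero; suc to fsuc)
  open import Data.Fin.Properties using (toℕ<n; toℕ-fromℕ<; toℕ-injective)
  open import Data.Vec using (Vec; []; _∷_; lookup; tabulate)
  open import Data.Vec.Properties using (lookup∘tabulate)
  open import Data.Product using (_×_; _,_)
  open import Data.Sum using (_⊎_; inj₁; inj₂)
  open import Relation.Nullary using (yes; no; contradiction)
  open import Relation.Binary.PropositionalEquality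

  open import Defs using (IsNonCrossingPairing)

  SameLineℕ : ℕ → ℕ → ℕ → Set
  SameLineℕ k i j = (i < k × j < k) ⊎ (k ≤ i × k ≤ j)

  Adjacentℕ : ℕ → ℕ → Set
  Adjacentℕ i j = (suc i ≡ j) ⊎ (suc j ≡ i)

  record NonCrossing (k n : ℕ) (F : ℕ → ℕ) : Set where
    field
      bounded : ∀ i → i < k + n → F i < k + n
      involutive : ∀ i → i < k + n → F (F i) ≡ i
      fixpoint-free : ∀ i → i < k + n → F i ≢ i
      sameLine⇒adjacent : ∀ i → i < k + n → SameLineℕ k i (F i) → Adjacentℕ i (F i)
      monotone-across : ∀ i j → i < k → k ≤ F i → j < k → k ≤ F j → i < j → F i < F j

  <k⇒<k+n : ∀ {i k n} → i < k → i < k + n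
  <k⇒<k+n {k = k} {n} i<k = ≤-trans i<k (m≤m+n k n)

  NonCrossing-cong : ∀ {k n F G} → NonCrossing k n F → (∀ i → i < k + n → F i ≡ G i) →
                     NonCrossing k n G
  NonCrossing-cong {k} {n} {F} {G} nc F≗G = record
    { bounded = λ i i< → subst (_< k + n) (F≗G i i<) (bounded i i<)
    ; involutive = λ i i< →
        trans (cong G (sym (F≗G i i<))) (trans (sym (F≗G (F i) (bounded i i<))) (involutive i i<))
    ; fixpoint-free = λ i i< eq → fixpoint-free i i< (trans (F≗G i i<) eq)
    ; sameLine⇒adjacent = λ i i< sl →
        subst (Adjacentℕ i) (F≗G i i<) (sameLine⇒adjacent i i< (subst (SameLineℕ k i) (sym (F≗G i i<)) sl))
    ; monotone-across = λ i j i<k k≤Gi j<k k≤Gj i<j →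
        subst₂ _<_ (F≗G i (<k⇒<k+n i<k)) (F≗G j (<k⇒<k+n j<k))
          (monotone-across i j i<k (subst (k ≤_) (sym (F≗G i (<k⇒<k+n i<k))) k≤Gi)
                                j<k (subst (k ≤_) (sym (F≗G j (<k⇒<k+n j<k))) k≤Gj) i<j)
    }
    where open NonCrossing nc

  -- Outside the range of the vector the value 0 is junk.
  lookupℕ : {N M : ℕ} → Vec (Fin N) M → ℕ → ℕ
  lookupℕ [] _ = 0
  lookupℕ (x ∷ xs) zero = toℕ x
  lookupℕ (x ∷ xs) (suc i) = lookupℕ xs i

  lookupℕ-toℕ : {N M : ℕ} (f : Vec (Fin N) M) (i : Fin M) → lookupℕ f (toℕ i) ≡ toℕ (lookup f i)
  lookupℕ-toℕ (x ∷ f) fzero = refl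
  lookupℕ-toℕ (x ∷ f) (fsuc i) = lookupℕ-toℕ f i

  lookupℕ-injective : {N M : ℕ} (f g : Vec (Fin N) M) →
                      (∀ i → i < M → lookupℕ f i ≡ lookupℕ g i) → f ≡ g
  lookupℕ-injective [] [] _ = refl
  lookupℕ-injective (x ∷ f) (y ∷ g) f≗g =
    cong₂ _∷_ (toℕ-injective (f≗g 0 (s≤s z≤n))) (lookupℕ-injective f g (λ i i< → f≗g (suc i) (s≤s i<)))

  ∀Fin⇒∀< : {N : ℕ} (P : ℕ → Set) → (∀ (i : Fin N) → P (toℕ i)) → ∀ i → i < N → P i
  ∀Fin⇒∀< P P-Fin i i< = subst P (toℕ-fromℕ< i<) (P-Fin (fromℕ< i<))

  ∀Fin²⇒∀< : {N : ℕ} (P : ℕ → ℕ → Set) → (∀ (x y : Fin N) → P (toℕ x) (toℕ y)) →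
             ∀ i j → i < N → j < N → P i j
  ∀Fin²⇒∀< P P-Fin i j i< j< = ∀Fin⇒∀< (λ i → P i j) (λ x → ∀Fin⇒∀< (P (toℕ x)) (P-Fin x) j j<) i i<

  -- The default value i is junk, used only when x is out of range.
  clamp : (N : ℕ) → ℕ → Fin N → Fin N
  clamp N x i with x <? N
  ... | yes x<N = fromℕ< x<N
  ... | no _ = i

  toℕ-clamp : ∀ {N x} (i : Fin N) → x < N → toℕ (clamp N x i) ≡ x
  toℕ-clamp {N} {x} i x<N with x <? N
  ... | yes x<N′ = toℕ-fromℕ< x<N′
  ... | no x≮N = contradiction x<N x≮N

  tabulateℕ : (N : ℕ) → (ℕ → ℕ) → Vec (Fin N) N
  tabulateℕ N h = tabulate (λ i → clamp N (h (toℕ i)) i)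

  lookupℕ-tabulateℕ : ∀ N h j → j < N → h j < N → lookupℕ (tabulateℕ N h) j ≡ h j
  lookupℕ-tabulateℕ N h = ∀Fin⇒∀< (λ j → h j < N → lookupℕ (tabulateℕ N h) j ≡ h j) at-Fin
    where
    at-Fin : ∀ (i : Fin N) → h (toℕ i) < N → lookupℕ (tabulateℕ N h) (toℕ i) ≡ h (toℕ i)
    at-Fin i h<N = begin
      lookupℕ (tabulateℕ N h) (toℕ i)        ≡⟨ lookupℕ-toℕ (tabulateℕ N h) i ⟩
      toℕ (lookup (tabulateℕ N h) i)         ≡⟨ cong toℕ (lookup∘tabulate _ i) ⟩
      toℕ (clamp N (h (toℕ i)) i)            ≡⟨ toℕ-clamp i h<N ⟩
      h (toℕ i)                              ∎
      where open ≡-Reasoning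

  module _ {k n : ℕ} (f : Vec (Fin (k + n)) (k + n)) where
    private
      F : ℕ → ℕ
      F = lookupℕ f
      L : ∀ i → F (toℕ i) ≡ toℕ (lookup f i)
      L = lookupℕ-toℕ f

    IsNonCrossingPairing⇒NonCrossing : IsNonCrossingPairing k n f → NonCrossing k n F
    IsNonCrossingPairing⇒NonCrossing (inv , nfx , adj , mono) = record
      { bounded = ∀Fin⇒∀< (λ i → F i < k + n) (λ x → subst (_< k + n) (sym (L x)) (toℕ<n (lookup f x)))
      ; involutive = ∀Fin⇒∀< (λ i → F (F i) ≡ i)
          (λ x → trans (cong F (L x)) (trans (L (lookup f x)) (cong toℕ (inv x))))
      ; fixpoint-free = ∀Fin⇒∀< (λ i → F i ≢ i) (λ x eq → nfx x (toℕ-injective (trans (sym (L x)) eq)))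
      ; sameLine⇒adjacent = ∀Fin⇒∀< (λ i → SameLineℕ k i (F i) → Adjacentℕ i (F i))
          (λ x sl → subst (Adjacentℕ (toℕ x)) (sym (L x)) (adj x (subst (SameLineℕ k (toℕ x)) (L x) sl)))
      ; monotone-across = λ i j i<k k≤Fi j<k →
          ∀Fin²⇒∀< (λ i j → i < k → k ≤ F i → j < k → k ≤ F j → i < j → F i < F j) mono′
            i j (<k⇒<k+n i<k) (<k⇒<k+n j<k) i<k k≤Fi j<k
      }
      where
      mono′ : ∀ x y → toℕ x < k → k ≤ F (toℕ x) → toℕ y < k → k ≤ F (toℕ y) →
              toℕ x < toℕ y → F (toℕ x) < F (toℕ y)
      mono′ x y x<k k≤Fx y<k k≤Fy x<y = subst₂ _<_ (sym (L x)) (sym (L y))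
        (mono x y x<k (subst (k ≤_) (L x) k≤Fx) y<k (subst (k ≤_) (L y) k≤Fy) x<y)

    NonCrossing⇒IsNonCrossingPairing : NonCrossing k n F → IsNonCrossingPairing k n f
    NonCrossing⇒IsNonCrossingPairing nc =
      (λ x → toℕ-injective
        (trans (sym (L (lookup f x))) (trans (cong F (sym (L x))) (involutive (toℕ x) (toℕ<n x))))) ,
      (λ x eq → fixpoint-free (toℕ x) (toℕ<n x) (trans (L x) (cong toℕ eq))) ,
      (λ x sl → subst (Adjacentℕ (toℕ x)) (L x)
        (sameLine⇒adjacent (toℕ x) (toℕ<n x) (subst (SameLineℕ k (toℕ x)) (sym (L x)) sl))) ,
      (λ x y x<k k≤fx y<k k≤fy x<y → subst₂ _<_ (L x) (L y)
         (monotone-across (toℕ x) (toℕ y) x<k (subst (k ≤_) (sym (L x)) k≤fx)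
                                        y<k (subst (k ≤_) (sym (L y)) k≤fy) x<y))
      where open NonCrossing nc

  SameLineℕ-sym : ∀ {k i j} → SameLineℕ k i j → SameLineℕ k j i
  SameLineℕ-sym (inj₁ (i< , j<)) = inj₁ (j< , i<)
  SameLineℕ-sym (inj₂ (≤i , ≤j)) = inj₂ (≤j , ≤i)

  Adjacentℕ-sym : ∀ {i j} → Adjacentℕ i j → Adjacentℕ j i
  Adjacentℕ-sym (inj₁ eq) = inj₂ eq
  Adjacentℕ-sym (inj₂ eq) = inj₁ eq

module Removal where

  open import Data.Nat using (ℕ; suc; _+_; _∸_; _≤_; _<_; s≤s; _<?_; _≤?_; _≟_)
  open import Data.Nat.Properties
  open import Data.Fin using (Fin)
  open import Data.Vec using (Vec)
  open import Data.Vec.Properties using (≡-dec)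
  import Data.Fin.Properties as Fin
  open import Data.List using (List; allFin)
  open import Data.List.Relation.Unary.Unique.Propositional.Properties using (allFin⁺)
  open import Data.List.Membership.Propositional.Properties using (∈-allFin)
  open import Data.Product using (_×_; _,_; proj₁; proj₂; ∃-syntax)
  open import Data.Sum using (_⊎_; inj₁; inj₂)
  import Data.Sum
  open import Relation.Nullary using (yes; no; contradiction)
  open import Relation.Unary using (Pred; Decidable)
  open import Relation.Binary.PropositionalEquality
  open import Relation.Binary.Definitions using (tri<; tri≈; tri>)
  open import Level using (0ℓ)
  open import Function using (_∘_)

  open import Defs using (allVecs; IsNonCrossingPairing)
  open Counting
  open IndexFunctions

  pairingVecs : (k n : ℕ) → List (Vec (Fin (k + n)) (k + n))
  pairingVecs k n = allVecs (allFin (k + n)) (k + n)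

  pairingVecs-isEnumeration : ∀ k n → IsEnumeration (pairingVecs k n)
  pairingVecs-isEnumeration k n =
    allVecs-isEnumeration (record { unique = allFin⁺ (k + n) ; complete = ∈-allFin }) (k + n)

  -- The configuration (k′ , n′) is placed inside (k , n) by skipping the first c points of the
  -- first line and the first 2 ∸ c points of the second line.
  module Embedding (k n k′ n′ c : ℕ) (k≡k′+c : k ≡ k′ + c) (c≤2 : c ≤ 2)
                   (N≡2+N′ : k + n ≡ suc (suc (k′ + n′))) where

    N N′ : ℕ
    N = k + n
    N′ = k′ + n′

    shift : ℕ → ℕ
    shift i with i <? k′
    ... | yes _ = i + c
    ... | no _ = i + 2

    unshift : ℕ → ℕ
    unshift j with j <? k
    ... | yes _ = j ∸ c
    ... | no _ = j ∸ 2

    shift-line₁ : ∀ {i} → i < k′ → shift i ≡ i + c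
    shift-line₁ {i} i< with i <? k′
    ... | yes _ = refl
    ... | no i≮ = contradiction i< i≮

    shift-line₂ : ∀ {i} → k′ ≤ i → shift i ≡ i + 2
    shift-line₂ {i} k′≤ with i <? k′
    ... | yes i< = contradiction k′≤ (<⇒≱ i<)
    ... | no _ = refl

    k≤k′+2 : k ≤ k′ + 2
    k≤k′+2 = subst (_≤ k′ + 2) (sym k≡k′+c) (+-monoʳ-≤ k′ c≤2)

    shift-<k : ∀ {i} → i < k′ → shift i < k
    shift-<k {i} i< = subst₂ _<_ (sym (shift-line₁ i<)) (sym k≡k′+c) (+-monoˡ-< c i<)

    shift-≥k : ∀ {i} → k′ ≤ i → k ≤ shift i
    shift-≥k {i} k′≤ = subst (k ≤_) (sym (shift-line₂ k′≤)) (≤-trans k≤k′+2 (+-monoˡ-≤ 2 k′≤))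

    shift-<k⁻ : ∀ i → shift i < k → i < k′
    shift-<k⁻ i s< with k′ ≤? i
    ... | yes k′≤ = contradiction (shift-≥k k′≤) (<⇒≱ s<)
    ... | no k′≰ = ≰⇒> k′≰

    shift-≥k⁻ : ∀ i → k ≤ shift i → k′ ≤ i
    shift-≥k⁻ i k≤ with k′ ≤? i
    ... | yes k′≤ = k′≤
    ... | no k′≰ = contradiction k≤ (<⇒≱ (shift-<k (≰⇒> k′≰)))

    shift-SameLine : ∀ {i j} → SameLineℕ k′ i j → SameLineℕ k (shift i) (shift j)
    shift-SameLine (inj₁ (i< , j<)) = inj₁ (shift-<k i< , shift-<k j<)
    shift-SameLine (inj₂ (≤i , ≤j)) = inj₂ (shift-≥k ≤i , shift-≥k ≤j)

    shift-SameLine⁻ : ∀ i j → SameLineℕ k (shift i) (shift j) → SameLineℕ k′ i j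
    shift-SameLine⁻ i j (inj₁ (i< , j<)) = inj₁ (shift-<k⁻ i i< , shift-<k⁻ j j<)
    shift-SameLine⁻ i j (inj₂ (≤i , ≤j)) = inj₂ (shift-≥k⁻ i ≤i , shift-≥k⁻ j ≤j)

    shift-mono-< : ∀ {i j} → i < j → shift i < shift j
    shift-mono-< {i} {j} i<j with i <? k′ | j <? k′
    ... | yes _ | yes _ = +-monoˡ-< c i<j
    ... | yes _ | no _ = +-mono-<-≤ i<j c≤2
    ... | no i≮ | yes j< = contradiction (<-trans i<j j<) i≮
    ... | no _ | no _ = +-monoˡ-< 2 i<j

    shift-cancel-< : ∀ i j → shift i < shift j → i < j
    shift-cancel-< i j s< with <-cmp i j
    ... | tri< i<j _ _ = i<j
    ... | tri≈ _ refl _ = contradiction s< (<-irrefl refl)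
    ... | tri> _ _ j<i = contradiction (shift-mono-< j<i) (<-asym s<)

    shift-injective : ∀ i j → shift i ≡ shift j → i ≡ j
    shift-injective i j eq with <-cmp i j
    ... | tri< i<j _ _ = contradiction eq (<⇒≢ (shift-mono-< i<j))
    ... | tri≈ _ i≡j _ = i≡j
    ... | tri> _ _ j<i = contradiction (sym eq) (<⇒≢ (shift-mono-< j<i))

    unshift-shift : ∀ i → unshift (shift i) ≡ i
    unshift-shift i with i <? k′
    ... | yes i< with i + c <? k
    ...   | yes _ = m+n∸n≡m i c
    ...   | no i+c≮ = contradiction (subst (i + c <_) (sym k≡k′+c) (+-monoˡ-< c i<)) i+c≮
    unshift-shift i | no i≮ with i + 2 <? k
    ...   | yes i+2< = contradiction (≤-trans k≤k′+2 (+-monoˡ-≤ 2 (≮⇒≥ i≮))) (<⇒≱ i+2<)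
    ...   | no _ = m+n∸n≡m i 2

    shift-<N : ∀ {i} → i < N′ → shift i < N
    shift-<N {i} i< = subst (shift i <_) (sym N≡2+N′) (≤-trans (s≤s shift≤i+2) i+2<)
      where
      shift≤i+2 : shift i ≤ i + 2
      shift≤i+2 with i <? k′
      ... | yes _ = +-monoʳ-≤ i c≤2
      ... | no _ = ≤-refl
      i+2< : suc (i + 2) ≤ suc (suc N′)
      i+2< = subst (_≤ suc (suc N′)) (+-comm 2 (suc i)) (+-monoʳ-≤ 2 i<)

    shift-avoids-gap : ∀ i → (c ≤ shift i × shift i < k) ⊎ 2 + k′ ≤ shift i
    shift-avoids-gap i with i <? k′
    ... | yes i< = inj₁ (m≤n+m c i , subst (i + c <_) (sym k≡k′+c) (+-monoˡ-< c i<))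
    ... | no i≮ = inj₂ (subst (_≤ i + 2) (+-comm k′ 2) (+-monoˡ-≤ 2 (≮⇒≥ i≮)))

    shift-onto-outside-gap : ∀ j → j < N → (c ≤ j × j < k) ⊎ 2 + k′ ≤ j → ∃[ i ] i < N′ × shift i ≡ j
    shift-onto-outside-gap j _ (inj₁ (c≤j , j<k)) = j ∸ c , <-≤-trans i<k′ (m≤m+n k′ n′) ,
      trans (shift-line₁ i<k′) (m∸n+n≡m c≤j)
      where
      i<k′ : j ∸ c < k′
      i<k′ = subst (j ∸ c <_) (m+n∸n≡m k′ c) (∸-monoˡ-< (subst (j <_) k≡k′+c j<k) c≤j)
    shift-onto-outside-gap j j<N (inj₂ 2+k′≤j) =
      j ∸ 2 , i<N′ , trans (shift-line₂ (∸-monoˡ-≤ 2 2+k′≤j)) (m∸n+n≡m 2≤j)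
      where
      2≤j : 2 ≤ j
      2≤j = ≤-trans (m≤m+n 2 k′) 2+k′≤j
      i<N′ : j ∸ 2 < N′
      i<N′ = ∸-monoˡ-< (subst (j <_) N≡2+N′ j<N) 2≤j

    shift-Adjacent : ∀ {i j} → SameLineℕ k′ i j → Adjacentℕ i j → Adjacentℕ (shift i) (shift j)
    shift-Adjacent (inj₁ (i< , j<)) adj rewrite shift-line₁ i< | shift-line₁ j< =
      Data.Sum.map (cong (_+ c)) (cong (_+ c)) adj
    shift-Adjacent (inj₂ (≤i , ≤j)) adj rewrite shift-line₂ ≤i | shift-line₂ ≤j =
      Data.Sum.map (cong (_+ 2)) (cong (_+ 2)) adj

    shift-Adjacent⁻ : ∀ {i j} → SameLineℕ k′ i j → Adjacentℕ (shift i) (shift j) → Adjacentℕ i j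
    shift-Adjacent⁻ (inj₁ (i< , j<)) adj rewrite shift-line₁ i< | shift-line₁ j< =
      Data.Sum.map (+-cancelʳ-≡ _ _ _) (+-cancelʳ-≡ _ _ _) adj
    shift-Adjacent⁻ (inj₂ (≤i , ≤j)) adj rewrite shift-line₂ ≤i | shift-line₂ ≤j =
      Data.Sum.map (+-cancelʳ-≡ _ _ _) (+-cancelʳ-≡ _ _ _) adj

    module PairRemoval (p q : ℕ) (p<N : p < N) (q<N : q < N) (p≢q : p ≢ q)
                       (shift≢p : ∀ i → shift i ≢ p) (shift≢q : ∀ i → shift i ≢ q)
                       (shift-onto : ∀ j → j < N → j ≢ p → j ≢ q → ∃[ i ] i < N′ × shift i ≡ j) where

      shift-unshift : ∀ j → j < N → j ≢ p → j ≢ q → shift (unshift j) ≡ j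
      shift-unshift j j< j≢p j≢q with shift-onto j j< j≢p j≢q
      ... | i , _ , refl = cong shift (unshift-shift i)

      unshift-<N′ : ∀ j → j < N → j ≢ p → j ≢ q → unshift j < N′
      unshift-<N′ j j< j≢p j≢q with shift-onto j j< j≢p j≢q
      ... | i , i< , refl = subst (_< N′) (sym (unshift-shift i)) i<

      data Point (j : ℕ) : Set where
        at-p : j ≡ p → Point j
        at-q : j ≡ q → Point j
        elsewhere : j ≢ p → j ≢ q → Point j

      point : ∀ j → Point j
      point j with j ≟ p | j ≟ q
      ... | yes j≡p | _ = at-p j≡p
      ... | no _ | yes j≡q = at-q j≡q
      ... | no j≢p | no j≢q = elsewhere j≢p j≢q

      restrict : (ℕ → ℕ) → ℕ → ℕ
      restrict F i = unshift (F (shift i))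

      extend : (ℕ → ℕ) → ℕ → ℕ
      extend G j with j ≟ p | j ≟ q
      ... | yes _ | _ = q
      ... | no _ | yes _ = p
      ... | no _ | no _ = shift (G (unshift j))

      extend-p : ∀ G → extend G p ≡ q
      extend-p G with p ≟ p
      ... | yes _ = refl
      ... | no p≢p = contradiction refl p≢p

      extend-q : ∀ G → extend G q ≡ p
      extend-q G with q ≟ p | q ≟ q
      ... | yes q≡p | _ = contradiction (sym q≡p) p≢q
      ... | no _ | yes _ = refl
      ... | no _ | no q≢q = contradiction refl q≢q

      extend-elsewhere : ∀ G {j} → j ≢ p → j ≢ q → extend G j ≡ shift (G (unshift j))
      extend-elsewhere G {j} j≢p j≢q with j ≟ p | j ≟ q
      ... | yes j≡p | _ = contradiction j≡p j≢p
      ... | no _ | yes j≡q = contradiction j≡q j≢q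
      ... | no _ | no _ = refl

      restrict-cong : ∀ F F′ → (∀ j → j < N → F j ≡ F′ j) → ∀ i → i < N′ → restrict F i ≡ restrict F′ i
      restrict-cong F F′ F≗F′ i i< = cong unshift (F≗F′ (shift i) (shift-<N i<))

      extend-cong : ∀ G G′ → (∀ i → i < N′ → G i ≡ G′ i) → ∀ j → j < N → extend G j ≡ extend G′ j
      extend-cong G G′ G≗G′ j j< with point j
      ... | at-p refl = trans (extend-p G) (sym (extend-p G′))
      ... | at-q refl = trans (extend-q G) (sym (extend-q G′))
      ... | elsewhere j≢p j≢q = begin
        extend G j                ≡⟨ extend-elsewhere G j≢p j≢q ⟩
        shift (G (unshift j))     ≡⟨ cong shift (G≗G′ (unshift j) (unshift-<N′ j j< j≢p j≢q)) ⟩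
        shift (G′ (unshift j))    ≡⟨ extend-elsewhere G′ j≢p j≢q ⟨
        extend G′ j               ∎
        where open ≡-Reasoning

      restrict-extend : ∀ G i → restrict (extend G) i ≡ G i
      restrict-extend G i = begin
        unshift (extend G (shift i))             ≡⟨ cong unshift (extend-elsewhere G (shift≢p i) (shift≢q i)) ⟩
        unshift (shift (G (unshift (shift i))))  ≡⟨ unshift-shift _ ⟩
        G (unshift (shift i))                    ≡⟨ cong G (unshift-shift i) ⟩
        G i                                      ∎
        where open ≡-Reasoning

      module Restriction {F : ℕ → ℕ} (nc : NonCrossing k n F) (Fp≡q : F p ≡ q) where
        open NonCrossing nc

        Fq≡p : F q ≡ p
        Fq≡p = trans (cong F (sym Fp≡q)) (involutive p p<N)

        private
          F∘shift-<N : ∀ {i} → i < N′ → F (shift i) < N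
          F∘shift-<N i< = bounded _ (shift-<N i<)

          F∘shift≢p : ∀ {i} → i < N′ → F (shift i) ≢ p
          F∘shift≢p {i} i< eq = shift≢q i (trans (sym (involutive _ (shift-<N i<))) (trans (cong F eq) Fp≡q))

          F∘shift≢q : ∀ {i} → i < N′ → F (shift i) ≢ q
          F∘shift≢q {i} i< eq = shift≢p i (trans (sym (involutive _ (shift-<N i<))) (trans (cong F eq) Fq≡p))

        shift-restrict : ∀ {i} → i < N′ → shift (restrict F i) ≡ F (shift i)
        shift-restrict i< = shift-unshift _ (F∘shift-<N i<) (F∘shift≢p i<) (F∘shift≢q i<)

        restrict-bounded : ∀ i → i < N′ → restrict F i < N′
        restrict-bounded i i< = unshift-<N′ _ (F∘shift-<N i<) (F∘shift≢p i<) (F∘shift≢q i<)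

        restrict-nonCrossing : NonCrossing k′ n′ (restrict F)
        restrict-nonCrossing = record
          { bounded = restrict-bounded
          ; involutive = λ i i< → begin
              unshift (F (shift (restrict F i)))  ≡⟨ cong (unshift ∘ F) (shift-restrict i<) ⟩
              unshift (F (F (shift i)))           ≡⟨ cong unshift (involutive _ (shift-<N i<)) ⟩
              unshift (shift i)                   ≡⟨ unshift-shift i ⟩
              i                                   ∎
          ; fixpoint-free = λ i i< eq →
              fixpoint-free _ (shift-<N i<) (trans (sym (shift-restrict i<)) (cong shift eq))
          ; sameLine⇒adjacent = λ i i< sl →
              shift-Adjacent⁻ sl (subst (Adjacentℕ (shift i)) (sym (shift-restrict i<))
                (sameLine⇒adjacent _ (shift-<N i<)
                  (subst (SameLineℕ k (shift i)) (shift-restrict i<) (shift-SameLine sl))))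
          ; monotone-across = λ i j i<k′ k′≤ j<k′ k′≤′ i<j →
              let i< = <k⇒<k+n {n = n′} i<k′
                  j< = <k⇒<k+n {n = n′} j<k′
              in shift-cancel-< _ _ (subst₂ _<_ (sym (shift-restrict i<)) (sym (shift-restrict j<))
                   (monotone-across _ _ (shift-<k i<k′) (subst (k ≤_) (shift-restrict i<) (shift-≥k k′≤))
                                        (shift-<k j<k′) (subst (k ≤_) (shift-restrict j<) (shift-≥k k′≤′))
                                        (shift-mono-< i<j)))
          }
          where open ≡-Reasoning

        extend-restrict : ∀ j → j < N → extend (restrict F) j ≡ F j
        extend-restrict j j< with point j
        ... | at-p refl = trans (extend-p _) (sym Fp≡q)
        ... | at-q refl = trans (extend-q _) (sym Fq≡p)
        ... | elsewhere j≢p j≢q = begin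
          extend (restrict F) j            ≡⟨ extend-elsewhere _ j≢p j≢q ⟩
          shift (restrict F (unshift j))   ≡⟨ shift-restrict (unshift-<N′ j j< j≢p j≢q) ⟩
          F (shift (unshift j))            ≡⟨ cong F (shift-unshift j j< j≢p j≢q) ⟩
          F j                              ∎
          where open ≡-Reasoning

      OnPair : ℕ → Set
      OnPair j = j ≡ p ⊎ j ≡ q

      MonotoneAcrossAtPair : (ℕ → ℕ) → Set
      MonotoneAcrossAtPair H =
        ∀ {j j′} → j < k → k ≤ H j → j′ < k → k ≤ H j′ → j < j′ → OnPair j ⊎ OnPair j′ → H j < H j′

      module Extension {G : ℕ → ℕ} (nc : NonCrossing k′ n′ G) where
        open NonCrossing nc
        open ≡-Reasoning

        H : ℕ → ℕ
        H = extend G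

        private
          module _ {j} (j< : j < N) (j≢p : j ≢ p) (j≢q : j ≢ q) where
            i : ℕ
            i = unshift j
            i< : i < N′
            i< = unshift-<N′ j j< j≢p j≢q
            shift-i≡j : shift i ≡ j
            shift-i≡j = shift-unshift j j< j≢p j≢q
            Hj≡ : H j ≡ shift (G i)
            Hj≡ = extend-elsewhere G j≢p j≢q

        extend-bounded : ∀ j → j < N → H j < N
        extend-bounded j j< with point j
        ... | at-p refl = subst (_< N) (sym (extend-p G)) q<N
        ... | at-q refl = subst (_< N) (sym (extend-q G)) p<N
        ... | elsewhere j≢p j≢q = subst (_< N) (sym (Hj≡ j< j≢p j≢q)) (shift-<N (bounded _ (i< j< j≢p j≢q)))

        extend-involutive : ∀ j → j < N → H (H j) ≡ j
        extend-involutive j j< with point j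
        ... | at-p refl = trans (cong H (extend-p G)) (extend-q G)
        ... | at-q refl = trans (cong H (extend-q G)) (extend-p G)
        ... | elsewhere j≢p j≢q = begin
          H (H j)                             ≡⟨ cong H (Hj≡ j< j≢p j≢q) ⟩
          H (shift (G i′))                    ≡⟨ extend-elsewhere G (shift≢p _) (shift≢q _) ⟩
          shift (G (unshift (shift (G i′))))  ≡⟨ cong (shift ∘ G) (unshift-shift _) ⟩
          shift (G (G i′))                    ≡⟨ cong shift (involutive i′ (i< j< j≢p j≢q)) ⟩
          shift i′                            ≡⟨ shift-i≡j j< j≢p j≢q ⟩
          j                                   ∎
          where i′ = unshift j

        extend-fixpoint-free : ∀ j → j < N → H j ≢ j
        extend-fixpoint-free j j< with point j
        ... | at-p refl = λ eq → p≢q (sym (trans (sym (extend-p G)) eq))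
        ... | at-q refl = λ eq → p≢q (trans (sym (extend-q G)) eq)
        ... | elsewhere j≢p j≢q = λ eq → fixpoint-free _ (i< j< j≢p j≢q)
          (shift-injective _ _ (trans (sym (Hj≡ j< j≢p j≢q)) (trans eq (sym (shift-i≡j j< j≢p j≢q)))))

        extend-sameLine⇒adjacent : (SameLineℕ k p q → Adjacentℕ p q) →
          ∀ j → j < N → SameLineℕ k j (H j) → Adjacentℕ j (H j)
        extend-sameLine⇒adjacent pq-adj j j< sl with point j
        ... | at-p refl = subst (Adjacentℕ p) (sym (extend-p G)) (pq-adj (subst (SameLineℕ k p) (extend-p G) sl))
        ... | at-q refl = subst (Adjacentℕ q) (sym (extend-q G))
                            (Adjacentℕ-sym (pq-adj (SameLineℕ-sym (subst (SameLineℕ k q) (extend-q G) sl))))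
        ... | elsewhere j≢p j≢q =
          subst₂ Adjacentℕ (shift-i≡j j< j≢p j≢q) (sym (Hj≡ j< j≢p j≢q))
            (shift-Adjacent sl′ (sameLine⇒adjacent _ (i< j< j≢p j≢q) sl′))
          where
          sl′ : SameLineℕ k′ (unshift j) (G (unshift j))
          sl′ = shift-SameLine⁻ _ _ (subst₂ (SameLineℕ k) (sym (shift-i≡j j< j≢p j≢q)) (Hj≡ j< j≢p j≢q) sl)

        extend-monotone-elsewhere : ∀ {j j′} → j < k → k ≤ H j → j′ < k → k ≤ H j′ → j < j′ →
          j ≢ p → j ≢ q → j′ ≢ p → j′ ≢ q → H j < H j′
        extend-monotone-elsewhere {j} {j′} j<k k≤ j′<k k≤′ j<j′ j≢p j≢q j′≢p j′≢q =
          subst₂ _<_ (sym Hj) (sym Hj′) (shift-mono-<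
            (monotone-across _ _ (shift-<k⁻ _ (subst (_< k) (sym s) j<k)) (shift-≥k⁻ _ (subst (k ≤_) Hj k≤))
                                 (shift-<k⁻ _ (subst (_< k) (sym s′) j′<k)) (shift-≥k⁻ _ (subst (k ≤_) Hj′ k≤′))
                                 (shift-cancel-< _ _ (subst₂ _<_ (sym s) (sym s′) j<j′))))
          where
          s = shift-i≡j (<k⇒<k+n {n = n} j<k) j≢p j≢q
          s′ = shift-i≡j (<k⇒<k+n {n = n} j′<k) j′≢p j′≢q
          Hj = Hj≡ (<k⇒<k+n {n = n} j<k) j≢p j≢q
          Hj′ = Hj≡ (<k⇒<k+n {n = n} j′<k) j′≢p j′≢q

        extend-nonCrossing : (SameLineℕ k p q → Adjacentℕ p q) → MonotoneAcrossAtPair H → NonCrossing k n H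
        extend-nonCrossing pq-adj pair-monotone = record
          { bounded = extend-bounded
          ; involutive = extend-involutive
          ; fixpoint-free = extend-fixpoint-free
          ; sameLine⇒adjacent = extend-sameLine⇒adjacent pq-adj
          ; monotone-across = monotone
          }
          where
          monotone : ∀ j j′ → j < k → k ≤ H j → j′ < k → k ≤ H j′ → j < j′ → H j < H j′
          monotone j j′ j<k k≤ j′<k k≤′ j<j′ with point j | point j′
          ... | at-p j≡p | _ = pair-monotone j<k k≤ j′<k k≤′ j<j′ (inj₁ (inj₁ j≡p))
          ... | at-q j≡q | _ = pair-monotone j<k k≤ j′<k k≤′ j<j′ (inj₁ (inj₂ j≡q))
          ... | elsewhere _ _ | at-p j′≡p = pair-monotone j<k k≤ j′<k k≤′ j<j′ (inj₂ (inj₁ j′≡p))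
          ... | elsewhere _ _ | at-q j′≡q = pair-monotone j<k k≤ j′<k k≤′ j<j′ (inj₂ (inj₂ j′≡q))
          ... | elsewhere j≢p j≢q | elsewhere j′≢p j′≢q =
            extend-monotone-elsewhere j<k k≤ j′<k k≤′ j<j′ j≢p j≢q j′≢p j′≢q

      restrictᵛ : Vec (Fin N) N → Vec (Fin N′) N′
      restrictᵛ f = tabulateℕ N′ (restrict (lookupℕ f))

      extendᵛ : Vec (Fin N′) N′ → Vec (Fin N) N
      extendᵛ g = tabulateℕ N (extend (lookupℕ g))

      module _ (f : Vec (Fin N) N) (ncp : IsNonCrossingPairing k n f) (fp≡q : lookupℕ f p ≡ q) where
        open Restriction (IsNonCrossingPairing⇒NonCrossing f ncp) fp≡q

        lookupℕ-restrictᵛ : ∀ i → i < N′ → lookupℕ (restrictᵛ f) i ≡ restrict (lookupℕ f) i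
        lookupℕ-restrictᵛ i i< = lookupℕ-tabulateℕ N′ _ i i< (restrict-bounded i i<)

        restrictᵛ-isNonCrossingPairing : IsNonCrossingPairing k′ n′ (restrictᵛ f)
        restrictᵛ-isNonCrossingPairing = NonCrossing⇒IsNonCrossingPairing (restrictᵛ f)
          (NonCrossing-cong restrict-nonCrossing (λ i i< → sym (lookupℕ-restrictᵛ i i<)))

      module _ (g : Vec (Fin N′) N′) (ncp : IsNonCrossingPairing k′ n′ g) where
        open Extension (IsNonCrossingPairing⇒NonCrossing g ncp)

        lookupℕ-extendᵛ : ∀ j → j < N → lookupℕ (extendᵛ g) j ≡ extend (lookupℕ g) j
        lookupℕ-extendᵛ j j< = lookupℕ-tabulateℕ N _ j j< (extend-bounded j j<)

        extendᵛ-p : lookupℕ (extendᵛ g) p ≡ q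
        extendᵛ-p = trans (lookupℕ-extendᵛ p p<N) (extend-p _)

        extendᵛ-isNonCrossingPairing : (SameLineℕ k p q → Adjacentℕ p q) → MonotoneAcrossAtPair H →
                                       IsNonCrossingPairing k n (extendᵛ g)
        extendᵛ-isNonCrossingPairing pq-adj pair-monotone = NonCrossing⇒IsNonCrossingPairing (extendᵛ g)
          (NonCrossing-cong (extend-nonCrossing pq-adj pair-monotone) (λ j j< → sym (lookupℕ-extendᵛ j j<)))

      count-removal : {P : Pred (Vec (Fin N) N) 0ℓ} {Q : Pred (Vec (Fin N′) N′) 0ℓ}
        (P? : Decidable P) (Q? : Decidable Q) →
        (∀ f → P f → IsNonCrossingPairing k n f × lookupℕ f p ≡ q) →
        (∀ g → Q g → IsNonCrossingPairing k′ n′ g) →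
        (∀ f → P f → Q (restrictᵛ f)) → (∀ g → Q g → P (extendᵛ g)) →
        count P? (pairingVecs k n) ≡ count Q? (pairingVecs k′ n′)
      count-removal {P = P} {Q} P? Q? P⇒ Q⇒ P⇒Q Q⇒P =
        count-≡-by-inverses P? Q? (≡-dec Fin._≟_) (≡-dec Fin._≟_)
          (pairingVecs-isEnumeration k n) (pairingVecs-isEnumeration k′ n′)
          restrictᵛ extendᵛ P⇒Q Q⇒P extend-restrictᵛ restrict-extendᵛ
        where
        extend-restrictᵛ : ∀ f → P f → extendᵛ (restrictᵛ f) ≡ f
        extend-restrictᵛ f Pf = lookupℕ-injective _ _ (pointwise (proj₁ (P⇒ f Pf)) (proj₂ (P⇒ f Pf)))
          where
          pointwise : IsNonCrossingPairing k n f → lookupℕ f p ≡ q →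
                      ∀ j → j < N → lookupℕ (extendᵛ (restrictᵛ f)) j ≡ lookupℕ f j
          pointwise nc fp≡q j j< = begin
            lookupℕ (extendᵛ (restrictᵛ f)) j
              ≡⟨ lookupℕ-extendᵛ (restrictᵛ f) (restrictᵛ-isNonCrossingPairing f nc fp≡q) j j< ⟩
            extend (lookupℕ (restrictᵛ f)) j
              ≡⟨ extend-cong _ _ (lookupℕ-restrictᵛ f nc fp≡q) j j< ⟩
            extend (restrict (lookupℕ f)) j
              ≡⟨ Restriction.extend-restrict (IsNonCrossingPairing⇒NonCrossing f nc) fp≡q j j< ⟩
            lookupℕ f j ∎
            where open ≡-Reasoning

        restrict-extendᵛ : ∀ g → Q g → restrictᵛ (extendᵛ g) ≡ g
        restrict-extendᵛ g Qg =
          lookupℕ-injective _ _ (pointwise (proj₁ (P⇒ _ (Q⇒P g Qg))) (proj₂ (P⇒ _ (Q⇒P g Qg))))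
          where
          pointwise : IsNonCrossingPairing k n (extendᵛ g) → lookupℕ (extendᵛ g) p ≡ q →
                      ∀ i → i < N′ → lookupℕ (restrictᵛ (extendᵛ g)) i ≡ lookupℕ g i
          pointwise nc fp≡q i i< = begin
            lookupℕ (restrictᵛ (extendᵛ g)) i   ≡⟨ lookupℕ-restrictᵛ (extendᵛ g) nc fp≡q i i< ⟩
            restrict (lookupℕ (extendᵛ g)) i    ≡⟨ restrict-cong _ _ (lookupℕ-extendᵛ g (Q⇒ g Qg)) i i< ⟩
            restrict (extend (lookupℕ g)) i     ≡⟨ restrict-extend _ i ⟩
            lookupℕ g i                         ∎
            where open ≡-Reasoning

module PairingCounts where

  open import Data.Nat using (ℕ; suc; _+_; _≤_; _<_; z≤n; s≤s; z<s; _<?_; _≤?_; _≟_)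
  open import Data.Nat.Properties
  open import Data.Fin using (Fin)
  open import Data.Vec using (Vec)
  open import Data.Product using (_×_; _,_; proj₁; ∃-syntax)
  open import Data.Sum using (inj₁; inj₂; [_,_]′)
  open import Data.Empty using (⊥; ⊥-elim)
  open import Relation.Nullary using (¬_; yes; no; contradiction)
  open import Relation.Unary using (Pred; Decidable)
  open import Relation.Unary.Properties using (_∩?_; ∁?)
  open import Level using (0ℓ)
  open import Relation.Binary.PropositionalEquality
  open import Relation.Binary.Definitions using (tri<; tri≈; tri>)
  open import Function using (_∘_; id)

  open import Defs using (IsNonCrossingPairing; isNonCrossingPairing?; aℕ)
  open Counting
  open IndexFunctions
  open Removal

  line₁-start-joined? : ∀ k n → Decidable (λ (f : Vec (Fin (k + n)) (k + n)) → lookupℕ f 0 ≡ 1)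
  line₁-start-joined? k n f = lookupℕ f 0 ≟ 1

  -- k ≤ f 0 says that point 0 is joined to the second line; for k = 0 every pairing qualifies.
  FirstJoinedAcross : (k n : ℕ) → Pred (Vec (Fin (k + n)) (k + n)) 0ℓ
  FirstJoinedAcross k n f = IsNonCrossingPairing k n f × k ≤ lookupℕ f 0

  firstJoinedAcross? : ∀ k n → Decidable (FirstJoinedAcross k n)
  firstJoinedAcross? k n = isNonCrossingPairing? k n ∩? (λ f → k ≤? lookupℕ f 0)

  bℕ : ℕ → ℕ → ℕ
  bℕ k n = count (firstJoinedAcross? k n) (pairingVecs k n)

  line₂-start-joined? : ∀ k n → Decidable (λ (f : Vec (Fin (k + n)) (k + n)) → lookupℕ f k ≡ suc k)
  line₂-start-joined? k n f = lookupℕ f k ≟ suc k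

  bℕ-split : ∀ k n → bℕ k n ≡ count (firstJoinedAcross? k n ∩? line₂-start-joined? k n) (pairingVecs k n)
                             + count (firstJoinedAcross? k n ∩? ∁? (line₂-start-joined? k n)) (pairingVecs k n)
  bℕ-split k n = count-split (firstJoinedAcross? k n) (line₂-start-joined? k n) (pairingVecs k n)

  count-first-two-joined : ∀ k n →
    count (isNonCrossingPairing? (2 + k) n ∩? (line₁-start-joined? (2 + k) n)) (pairingVecs (2 + k) n) ≡ aℕ k n
  count-first-two-joined k n =
    count-removal (isNonCrossingPairing? (2 + k) n ∩? (line₁-start-joined? (2 + k) n)) (isNonCrossingPairing? k n)
      (λ _ → id) (λ _ → id) (λ f (nc , f0≡1) → restrictᵛ-isNonCrossingPairing f nc f0≡1) joined
    where
    open Embedding (2 + k) n k n 2 (+-comm 2 k) ≤-refl refl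

    shift≡2+ : ∀ i → shift i ≡ 2 + i
    shift≡2+ i with i <? k
    ... | yes _ = +-comm i 2
    ... | no _ = +-comm i 2

    onto : ∀ j → j < N → j ≢ 0 → j ≢ 1 → ∃[ i ] i < N′ × shift i ≡ j
    onto 0 _ j≢0 _ = contradiction refl j≢0
    onto 1 _ _ j≢1 = contradiction refl j≢1
    onto (suc (suc i)) (s≤s (s≤s i<)) _ _ = i , i< , shift≡2+ i

    open PairRemoval 0 1 (s≤s z≤n) (s≤s (s≤s z≤n)) (λ ()) (λ i eq → 0≢1+n (trans (sym eq) (shift≡2+ i)))
                     (λ i eq → 0≢1+n (sym (suc-injective (trans (sym (shift≡2+ i)) eq)))) onto

    joined : ∀ g → IsNonCrossingPairing k n g →
             IsNonCrossingPairing (2 + k) n (extendᵛ g) × lookupℕ (extendᵛ g) 0 ≡ 1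
    joined g nc = extendᵛ-isNonCrossingPairing g nc (λ _ → inj₁ refl)
                    (λ j<k k≤ j′<k k≤′ _ → ⊥-elim ∘ [ not-across j<k k≤ , not-across j′<k k≤′ ]′) ,
                  extendᵛ-p g nc
      where
      open Extension (IsNonCrossingPairing⇒NonCrossing g nc)
      not-across : ∀ {j} → j < 2 + k → 2 + k ≤ H j → OnPair j → ⊥
      not-across _ k≤ (inj₁ refl) with s≤s () ← subst (2 + k ≤_) (extend-p (lookupℕ g)) k≤
      not-across _ k≤ (inj₂ refl) with () ← subst (2 + k ≤_) (extend-q (lookupℕ g)) k≤

  count-first-two-of-line₂-joined : ∀ k n →
    count (firstJoinedAcross? k (2 + n) ∩? (line₂-start-joined? k (2 + n))) (pairingVecs k (2 + n)) ≡ bℕ k n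
  count-first-two-of-line₂-joined k n =
    count-removal (firstJoinedAcross? k (2 + n) ∩? (line₂-start-joined? k (2 + n))) (firstJoinedAcross? k n)
      (λ _ ((nc , _) , fk≡1+k) → nc , fk≡1+k) (λ _ → proj₁)
      (λ f ((nc , k≤f0) , fk≡1+k) →
         restrictᵛ-isNonCrossingPairing f nc fk≡1+k , restrict-first-across f nc fk≡1+k k≤f0)
      joined
    where
    open Embedding k (2 + n) k n 0 (sym (+-identityʳ k)) z≤n (trans (+-suc k (suc n)) (cong suc (+-suc k n)))

    shift≢k : ∀ i → shift i ≢ k
    shift≢k i eq with shift-avoids-gap i
    ... | inj₁ (_ , i<k) = <-irrefl eq i<k
    ... | inj₂ 2+k≤ = <⇒≱ (m<n+m k z<s) (subst (2 + k ≤_) eq 2+k≤)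

    shift≢1+k : ∀ i → shift i ≢ suc k
    shift≢1+k i eq with shift-avoids-gap i
    ... | inj₁ (_ , i<k) = <-asym (subst (_< k) eq i<k) (n<1+n k)
    ... | inj₂ 2+k≤ = 1+n≰n (subst (2 + k ≤_) eq 2+k≤)

    onto : ∀ j → j < N → j ≢ k → j ≢ suc k → ∃[ i ] i < N′ × shift i ≡ j
    onto j j<N j≢k j≢1+k with j <? k
    ... | yes j<k = shift-onto-outside-gap j j<N (inj₁ (z≤n , j<k))
    ... | no j≮k = shift-onto-outside-gap j j<N
      (inj₂ (≤∧≢⇒< (≤∧≢⇒< (≮⇒≥ j≮k) (j≢k ∘ sym)) (j≢1+k ∘ sym)))

    open PairRemoval k (suc k) (m<m+n k z<s) (subst (suc k <_) (sym (+-suc k (suc n))) (s≤s (m<m+n k z<s)))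
                     (<⇒≢ (n<1+n k)) shift≢k shift≢1+k onto

    restrict-first-across : ∀ f → IsNonCrossingPairing k (2 + n) f → lookupℕ f k ≡ suc k →
                            k ≤ lookupℕ f 0 → k ≤ lookupℕ (restrictᵛ f) 0
    restrict-first-across f nc fk≡1+k k≤f0 with 0 <? k
    ... | no 0≮k = ≤-trans (≮⇒≥ 0≮k) z≤n
    ... | yes 0<k = begin
      k                                ≤⟨ shift-≥k⁻ _ k≤shift-restrict ⟩
      restrict (lookupℕ f) 0           ≡⟨ lookupℕ-restrictᵛ f nc fk≡1+k 0 0<N′ ⟨
      lookupℕ (restrictᵛ f) 0          ∎
      where
      open ≤-Reasoning
      open Restriction (IsNonCrossingPairing⇒NonCrossing f nc) fk≡1+k
      0<N′ : 0 < k + n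
      0<N′ = <-≤-trans 0<k (m≤m+n k n)
      k≤shift-restrict : k ≤ shift (restrict (lookupℕ f) 0)
      k≤shift-restrict = begin
        k                                ≤⟨ k≤f0 ⟩
        lookupℕ f 0                      ≡⟨ cong (lookupℕ f) (shift-line₁ 0<k) ⟨
        lookupℕ f (shift 0)              ≡⟨ shift-restrict 0<N′ ⟨
        shift (restrict (lookupℕ f) 0)   ∎

    joined : ∀ g → FirstJoinedAcross k n g →
             FirstJoinedAcross k (2 + n) (extendᵛ g) × lookupℕ (extendᵛ g) k ≡ suc k
    joined g (nc , k≤g0) =
      (extendᵛ-isNonCrossingPairing g nc (λ _ → inj₁ refl)
         (λ j<k _ j′<k _ _ → ⊥-elim ∘ [ not-line₁ j<k , not-line₁ j′<k ]′) , extend-first-across) ,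
      extendᵛ-p g nc
      where
      open Extension (IsNonCrossingPairing⇒NonCrossing g nc)
      not-line₁ : ∀ {j} → j < k → OnPair j → ⊥
      not-line₁ j<k (inj₁ refl) = <-irrefl refl j<k
      not-line₁ j<k (inj₂ refl) = <-asym j<k (n<1+n k)
      extend-first-across : k ≤ lookupℕ (extendᵛ g) 0
      extend-first-across with 0 <? k
      ... | no 0≮k = ≤-trans (≮⇒≥ 0≮k) z≤n
      ... | yes 0<k = begin
        k                                ≤⟨ shift-≥k k≤g0 ⟩
        shift (lookupℕ g 0)              ≡⟨ cong (shift ∘ lookupℕ g) unshift-0 ⟨
        shift (lookupℕ g (unshift 0))    ≡⟨ extend-elsewhere _ (<⇒≢ 0<k) (<⇒≢ (<-trans 0<k (n<1+n k))) ⟨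
        H 0                              ≡⟨ lookupℕ-extendᵛ g nc 0 (<-≤-trans 0<k (m≤m+n k (2 + n))) ⟨
        lookupℕ (extendᵛ g) 0            ∎
        where
        open ≤-Reasoning
        unshift-0 : unshift 0 ≡ 0
        unshift-0 = trans (cong unshift (sym (shift-line₁ 0<k))) (unshift-shift 0)

  first-points-joined : ∀ {k n F} → NonCrossing (suc k) (suc n) F →
    suc k ≤ F 0 → F (suc k) ≢ 2 + k → F 0 ≡ suc k
  first-points-joined {k} {n} {F} nc K≤F0 FK≢1+K with <-cmp (F 0) (suc k)
  ... | tri< F0<K _ _ = contradiction K≤F0 (<⇒≱ F0<K)
  ... | tri≈ _ F0≡K _ = F0≡K
  ... | tri> _ _ K<F0 = contradiction (subst (F 0 <_) Fj≡K F0<Fj) (<-asym K<F0)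
    where
    open NonCrossing nc
    K<N : suc k < suc k + suc n
    K<N = m<m+n (suc k) z<s
    j : ℕ
    j = F (suc k)
    Fj≡K : F j ≡ suc k
    Fj≡K = involutive (suc k) K<N
    j<K : j < suc k
    j<K with <-cmp j (suc k)
    ... | tri< j<K _ _ = j<K
    ... | tri≈ _ j≡K _ = contradiction j≡K (fixpoint-free (suc k) K<N)
    ... | tri> _ _ K<j with sameLine⇒adjacent (suc k) K<N (inj₂ (≤-refl , <⇒≤ K<j))
    ...   | inj₁ 1+K≡j = contradiction (sym 1+K≡j) FK≢1+K
    ...   | inj₂ 1+j≡K = contradiction (≤-reflexive 1+j≡K) (<-asym K<j)
    0<j : 0 < j
    0<j = n≢0⇒n>0 λ j≡0 → <-irrefl (trans (sym Fj≡K) (cong F j≡0)) K<F0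
    F0<Fj : F 0 < F j
    F0<Fj = monotone-across 0 j z<s K≤F0 j<K (≤-reflexive (sym Fj≡K)) 0<j

  count-first-points-joined : ∀ k n →
    count (firstJoinedAcross? (suc k) (suc n) ∩? ∁? (line₂-start-joined? (suc k) (suc n)))
          (pairingVecs (suc k) (suc n))
      ≡ aℕ k n
  count-first-points-joined k n =
    count-removal P? (isNonCrossingPairing? k n)
      (λ f Pf → proj₁ (proj₁ Pf) , first-points-joinedᵛ f Pf)
      (λ _ → id)
      (λ f Pf → restrictᵛ-isNonCrossingPairing f (proj₁ (proj₁ Pf)) (first-points-joinedᵛ f Pf))
      joined
    where
    P : Pred (Vec (Fin (suc k + suc n)) (suc k + suc n)) 0ℓ
    P f = FirstJoinedAcross (suc k) (suc n) f × lookupℕ f (suc k) ≢ 2 + k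

    P? : Decidable P
    P? = firstJoinedAcross? (suc k) (suc n) ∩? ∁? (line₂-start-joined? (suc k) (suc n))

    first-points-joinedᵛ : ∀ f → P f → lookupℕ f 0 ≡ suc k
    first-points-joinedᵛ f ((nc , K≤f0) , fK≢) =
      first-points-joined (IsNonCrossingPairing⇒NonCrossing f nc) K≤f0 fK≢

    open Embedding (suc k) (suc n) k n 1 (+-comm 1 k) (s≤s z≤n) (cong suc (+-suc k n))

    shift≢0 : ∀ i → shift i ≢ 0
    shift≢0 i eq with shift-avoids-gap i
    ... | inj₁ (1≤ , _) = <⇒≢ 1≤ (sym eq)
    ... | inj₂ 2+k≤ with () ← subst (2 + k ≤_) eq 2+k≤

    shift≢1+k : ∀ i → shift i ≢ suc k
    shift≢1+k i eq with shift-avoids-gap i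
    ... | inj₁ (_ , i<K) = <-irrefl eq i<K
    ... | inj₂ 2+k≤ = 1+n≰n (subst (2 + k ≤_) eq 2+k≤)

    onto : ∀ j → j < N → j ≢ 0 → j ≢ suc k → ∃[ i ] i < N′ × shift i ≡ j
    onto j j<N j≢0 j≢1+k with j <? suc k
    ... | yes j<K = shift-onto-outside-gap j j<N (inj₁ (n≢0⇒n>0 j≢0 , j<K))
    ... | no j≮K = shift-onto-outside-gap j j<N (inj₂ (≤∧≢⇒< (≮⇒≥ j≮K) (j≢1+k ∘ sym)))

    open PairRemoval 0 (suc k) z<s (m<m+n (suc k) z<s) (λ ()) shift≢0 shift≢1+k onto

    joined : ∀ g → IsNonCrossingPairing k n g →
      (FirstJoinedAcross (suc k) (suc n) (extendᵛ g)) × lookupℕ (extendᵛ g) (suc k) ≢ 2 + k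
    joined g nc =
      (extendᵛ-isNonCrossingPairing g nc pq-not-sameLine pair-monotone , ≤-reflexive (sym (extendᵛ-p g nc))) ,
      λ eq → 0≢1+n (trans (sym gK≡0) eq)
      where
      open Extension (IsNonCrossingPairing⇒NonCrossing g nc)
      gK≡0 : lookupℕ (extendᵛ g) (suc k) ≡ 0
      gK≡0 = trans (lookupℕ-extendᵛ g nc (suc k) (m<m+n (suc k) z<s)) (extend-q _)
      pq-not-sameLine : SameLineℕ (suc k) 0 (suc k) → Adjacentℕ 0 (suc k)
      pq-not-sameLine (inj₁ (_ , K<K)) = contradiction K<K (<-irrefl refl)
      pq-not-sameLine (inj₂ (K≤0 , _)) = contradiction K≤0 λ ()
      pair-monotone : MonotoneAcrossAtPair H
      pair-monotone {j′ = j′} _ _ j′<K K≤Hj′ 0<j′ (inj₁ (inj₁ refl)) =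
        subst (_< H j′) (sym (extend-p (lookupℕ g))) (≤∧≢⇒< K≤Hj′ λ K≡Hj′ → <-irrefl (sym (j′≡0 K≡Hj′)) 0<j′)
        where
        j′≡0 : suc k ≡ H j′ → j′ ≡ 0
        j′≡0 K≡Hj′ = trans (sym (extend-involutive j′ (<-≤-trans j′<K (m≤m+n (suc k) (suc n)))))
                           (trans (cong H (sym K≡Hj′)) (extend-q _))
      pair-monotone j<K _ _ _ _ (inj₁ (inj₂ refl)) = contradiction j<K (<-irrefl refl)
      pair-monotone _ _ _ _ j<j′ (inj₂ (inj₁ refl)) = contradiction j<j′ n≮0
      pair-monotone _ _ j′<K _ _ (inj₂ (inj₂ refl)) = contradiction j′<K (<-irrefl refl)

  aℕ-2+ : ∀ k n → aℕ (2 + k) n ≡ aℕ k n + bℕ (2 + k) n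
  aℕ-2+ k n =
    trans (count-split (isNonCrossingPairing? (2 + k) n) (line₁-start-joined? (2 + k) n) (pairingVecs (2 + k) n))
          (cong₂ _+_ (count-first-two-joined k n)
                     (count-cong (isNonCrossingPairing? (2 + k) n ∩? ∁? (line₁-start-joined? (2 + k) n))
                                 (firstJoinedAcross? (2 + k) n)
                                 ((λ {f} → to f) , (λ {f} → from f)) (pairingVecs (2 + k) n)))
    where
    to : ∀ f → IsNonCrossingPairing (2 + k) n f × lookupℕ f 0 ≢ 1 → FirstJoinedAcross (2 + k) n f
    to f (nc , f0≢1) with lookupℕ f 0 <? 2 + k
    ... | no f0≮ = nc , ≮⇒≥ f0≮
    ... | yes f0<
      with NonCrossing.sameLine⇒adjacent (IsNonCrossingPairing⇒NonCrossing f nc) 0 z<s (inj₁ (z<s , f0<))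
    ...   | inj₁ 1≡f0 = contradiction (sym 1≡f0) f0≢1
    from : ∀ f → FirstJoinedAcross (2 + k) n f → IsNonCrossingPairing (2 + k) n f × lookupℕ f 0 ≢ 1
    from _ (nc , 2+k≤f0) = nc , λ f0≡1 → contradiction (subst (2 + k ≤_) f0≡1 2+k≤f0) λ { (s≤s ()) }

  aℕ≡bℕ : ∀ {k} n → k ≤ 1 → aℕ k n ≡ bℕ k n
  aℕ≡bℕ {k} n k≤1 = count-cong (isNonCrossingPairing? k n) (firstJoinedAcross? k n)
    ((λ {f} nc → nc , first-across k≤1 f nc) , proj₁) (pairingVecs k n)
    where
    first-across : k ≤ 1 → ∀ f → IsNonCrossingPairing k n f → k ≤ lookupℕ f 0
    first-across z≤n _ _ = z≤n
    first-across (s≤s z≤n) f nc =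
      n≢0⇒n>0 (NonCrossing.fixpoint-free (IsNonCrossingPairing⇒NonCrossing f nc) 0 z<s)

  count-line₂-start-joined-1 : ∀ k →
    count (firstJoinedAcross? k 1 ∩? line₂-start-joined? k 1) (pairingVecs k 1) ≡ 0
  count-line₂-start-joined-1 k = count-none _ out-of-range (pairingVecs k 1)
    where
    out-of-range : ∀ f → ¬ (FirstJoinedAcross k 1 f × lookupℕ f k ≡ suc k)
    out-of-range f ((nc , _) , fk≡1+k) = <-irrefl (+-comm 1 k) (subst (_< k + 1) fk≡1+k fk<)
      where
      fk< : lookupℕ f k < k + 1
      fk< = NonCrossing.bounded (IsNonCrossingPairing⇒NonCrossing f nc) k (m<m+n k z<s)

  count-k0-line₂-start-unjoined : ∀ n →
    count (firstJoinedAcross? 0 (suc n) ∩? ∁? (line₂-start-joined? 0 (suc n))) (pairingVecs 0 (suc n)) ≡ 0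
  count-k0-line₂-start-unjoined n = count-none _ forced-adjacent (pairingVecs 0 (suc n))
    where
    forced-adjacent : ∀ f → ¬ (FirstJoinedAcross 0 (suc n) f × lookupℕ f 0 ≢ 1)
    forced-adjacent f ((nc , _) , f0≢1)
      with NonCrossing.sameLine⇒adjacent (IsNonCrossingPairing⇒NonCrossing f nc) 0 z<s (inj₂ (z≤n , z≤n))
    ... | inj₁ 1≡f0 = f0≢1 (sym 1≡f0)

  bℕ-suc-0 : ∀ k → bℕ (suc k) 0 ≡ 0
  bℕ-suc-0 k = count-none _ out-of-range (pairingVecs (suc k) 0)
    where
    out-of-range : ∀ f → ¬ FirstJoinedAcross (suc k) 0 f
    out-of-range f (nc , K≤f0) = <⇒≱ (subst (lookupℕ f 0 <_) (+-identityʳ (suc k)) f0<) K≤f0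
      where
      f0< : lookupℕ f 0 < suc k + 0
      f0< = NonCrossing.bounded (IsNonCrossingPairing⇒NonCrossing f nc) 0 z<s

  bℕ-suc-2+ : ∀ k n → bℕ (suc k) (2 + n) ≡ bℕ (suc k) n + aℕ k (suc n)
  bℕ-suc-2+ k n = trans (bℕ-split (suc k) (2 + n))
    (cong₂ _+_ (count-first-two-of-line₂-joined (suc k) n) (count-first-points-joined k (suc n)))

  bℕ-zero-2+ : ∀ n → bℕ 0 (2 + n) ≡ bℕ 0 n + 0
  bℕ-zero-2+ n = trans (bℕ-split 0 (2 + n))
    (cong₂ _+_ (count-first-two-of-line₂-joined 0 n) (count-k0-line₂-start-unjoined (suc n)))

  bℕ-suc-1 : ∀ k → bℕ (suc k) 1 ≡ 0 + aℕ k 0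
  bℕ-suc-1 k = trans (bℕ-split (suc k) 1)
    (cong₂ _+_ (count-line₂-start-joined-1 (suc k)) (count-first-points-joined k 0))

  bℕ-zero-1 : bℕ 0 1 ≡ 0 + 0
  bℕ-zero-1 = trans (bℕ-split 0 1)
    (cong₂ _+_ (count-line₂-start-joined-1 0) (count-k0-line₂-start-unjoined 0))

module PairingRecurrence where

  open import Data.Nat as ℕ using (ℕ; zero; suc)
  import Data.Nat.Properties as ℕ
  open import Data.Integer using (ℤ; +_; -[1+_]; _+_; _-_)
  open import Data.Integer.Tactic.RingSolver using (solve-∀)
  open import Relation.Nullary using (contradiction)
  open import Relation.Binary.PropositionalEquality

  open import Defs using (aℕ; a)
  open PairingCounts
  open Recurrence

  b : ℤ → ℤ → ℕ
  b (+ k) (+ n) = bℕ k n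
  b (+ k) -[1+ n ] = 0
  b -[1+ k ] n = 0

  a-+2 : ∀ x y → a (x + + 2) y ≡ a x y ℕ.+ b (x + + 2) y
  a-+2 (+ k) (+ n) = begin
    aℕ (k ℕ.+ 2) n                  ≡⟨ cong (λ m → aℕ m n) (ℕ.+-comm k 2) ⟩
    aℕ (2 ℕ.+ k) n                  ≡⟨ aℕ-2+ k n ⟩
    aℕ k n ℕ.+ bℕ (2 ℕ.+ k) n        ≡⟨ cong (λ m → aℕ k n ℕ.+ bℕ m n) (ℕ.+-comm 2 k) ⟩
    aℕ k n ℕ.+ bℕ (k ℕ.+ 2) n        ∎
    where open ≡-Reasoning
  a-+2 (+ k) -[1+ n ] = refl
  a-+2 -[1+ 0 ] (+ n) = aℕ≡bℕ n (ℕ.s≤s ℕ.z≤n)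
  a-+2 -[1+ 1 ] (+ n) = aℕ≡bℕ n ℕ.z≤n
  a-+2 -[1+ 0 ] -[1+ n ] = refl
  a-+2 -[1+ 1 ] -[1+ n ] = refl
  a-+2 -[1+ suc (suc k) ] y = refl

  -- At x = 0, y = -2 the identity fails: the empty pairing, counted by b 0 0, has no pair to remove.
  b-+2 : ∀ x y → x + y ≢ -[1+ 1 ] → b x (y + + 2) ≡ b x y ℕ.+ a (x - + 1) (y + + 1)
  b-+2 (+ zero) (+ n) _ = trans (cong (bℕ 0) (ℕ.+-comm n 2)) (bℕ-zero-2+ n)
  b-+2 (+ zero) -[1+ 0 ] _ = bℕ-zero-1
  b-+2 (+ zero) -[1+ 1 ] x+y≢-2 = contradiction refl x+y≢-2
  b-+2 (+ zero) -[1+ suc (suc j) ] _ = refl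
  b-+2 (+ suc k) (+ n) _ = begin
    bℕ (suc k) (n ℕ.+ 2)                    ≡⟨ cong (bℕ (suc k)) (ℕ.+-comm n 2) ⟩
    bℕ (suc k) (2 ℕ.+ n)                    ≡⟨ bℕ-suc-2+ k n ⟩
    bℕ (suc k) n ℕ.+ aℕ k (suc n)           ≡⟨ cong (λ m → bℕ (suc k) n ℕ.+ aℕ k m) (ℕ.+-comm 1 n) ⟩
    bℕ (suc k) n ℕ.+ aℕ k (n ℕ.+ 1)         ∎
    where open ≡-Reasoning
  b-+2 (+ suc k) -[1+ 0 ] _ = bℕ-suc-1 k
  b-+2 (+ suc k) -[1+ 1 ] _ = bℕ-suc-0 k
  b-+2 (+ suc k) -[1+ suc (suc j) ] _ = refl
  b-+2 -[1+ k ] y _ = refl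

  pairingCount pairingCount⁺ : ℕ → ℤ → ℕ
  pairingCount N n = a (+ N - n) (+ N + n)
  pairingCount⁺ N n = b (+ N - n) (+ N + n)

  pairings-peaklessRecurrence : PeaklessRecurrence pairingCount pairingCount⁺
  pairings-peaklessRecurrence = record { A-suc = A-suc ; B-suc = B-suc }
    where
    open ≡-Reasoning

    A-suc : ∀ N n → pairingCount (suc N) n ≡ pairingCount⁺ (suc N) n ℕ.+ pairingCount N (n + + 1)
    A-suc N n = begin
      a (+ suc N - n) (+ suc N + n)                          ≡⟨ cong₂ a (sym x+2≡) y≡ ⟩
      a (x + + 2) y                                          ≡⟨ a-+2 x y ⟩
      a x y ℕ.+ b (x + + 2) y                                ≡⟨ cong₂ (λ u v → a x y ℕ.+ b u v) x+2≡ (sym y≡) ⟩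
      pairingCount N (n + + 1) ℕ.+ pairingCount⁺ (suc N) n   ≡⟨ ℕ.+-comm _ (pairingCount⁺ (suc N) n) ⟩
      pairingCount⁺ (suc N) n ℕ.+ pairingCount N (n + + 1)   ∎
      where
      x y : ℤ
      x = + N - (n + + 1)
      y = + N + (n + + 1)
      x+2≡ : x + + 2 ≡ + suc N - n
      x+2≡ = lemma (+ N) n
        where
        lemma : ∀ P n → P - (n + + 1) + + 2 ≡ + 1 + P - n
        lemma = solve-∀
      y≡ : + suc N + n ≡ y
      y≡ = lemma (+ N) n
        where
        lemma : ∀ P n → + 1 + P + n ≡ P + (n + + 1)
        lemma = solve-∀

    B-suc : ∀ N n → pairingCount⁺ (suc N) n ≡ pairingCount⁺ N (n - + 1) ℕ.+ pairingCount N n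
    B-suc N n = begin
      b (+ suc N - n) (+ suc N + n)                          ≡⟨ cong₂ b x≡ (sym y+2≡) ⟩
      b x (y + + 2)                                          ≡⟨ b-+2 x y x+y≢-2 ⟩
      b x y ℕ.+ a (x - + 1) (y + + 1)                        ≡⟨ cong₂ (λ u v → b x y ℕ.+ a u v) x-1≡ y+1≡ ⟩
      pairingCount⁺ N (n - + 1) ℕ.+ pairingCount N n         ∎
      where
      x y : ℤ
      x = + N - (n - + 1)
      y = + N + (n - + 1)
      x≡ : + suc N - n ≡ x
      x≡ = lemma (+ N) n
        where
        lemma : ∀ P n → + 1 + P - n ≡ P - (n - + 1)
        lemma = solve-∀
      y+2≡ : y + + 2 ≡ + suc N + n
      y+2≡ = lemma (+ N) n
        where
        lemma : ∀ P n → P + (n - + 1) + + 2 ≡ + 1 + P + n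
        lemma = solve-∀
      x-1≡ : x - + 1 ≡ + N - n
      x-1≡ = lemma (+ N) n
        where
        lemma : ∀ P n → P - (n - + 1) - + 1 ≡ P - n
        lemma = solve-∀
      y+1≡ : y + + 1 ≡ + N + n
      y+1≡ = lemma (+ N) n
        where
        lemma : ∀ P n → P + (n - + 1) + + 1 ≡ P + n
        lemma = solve-∀
      x+y≢-2 : x + y ≢ -[1+ 1 ]
      x+y≢-2 eq = 2N≢-2 (trans (sym (lemma (+ N) n)) eq)
        where
        lemma : ∀ P n → P - (n - + 1) + (P + (n - + 1)) ≡ P + P
        lemma = solve-∀
        2N≢-2 : + (N ℕ.+ N) ≢ -[1+ 1 ]
        2N≢-2 ()

open import Data.Nat using (ℕ; zero; suc)
open import Data.Integer using (ℤ; +_; -[1+_]; _+_; _-_)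
open import Data.Product using (proj₁)
open import Relation.Binary.PropositionalEquality using (_≡_; refl)

open import Defs
open Recurrence
open PathCounts
open PairingRecurrence

theorem1 : (k : ℕ) (n : ℤ) → m k n ≡ a (+ k - n) (+ k + n)
theorem1 k n = proj₁ (PeaklessRecurrence-unique paths-peaklessRecurrence pairings-peaklessRecurrence
                        initial initial⁺ k n)
  where
  initial : ∀ n → m 0 n ≡ pairingCount 0 n
  initial (+ zero) = refl
  initial (+ suc _) = refl
  initial -[1+ _ ] = refl
  initial⁺ : ∀ n → m⁺ 0 n ≡ pairingCount⁺ 0 n
  initial⁺ (+ zero) = refl
  initial⁺ (+ suc _) = refl
  initial⁺ -[1+ _ ] = refl
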